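{- Let $i\in[n]$ and let $C$ be an admissible column such that $f_i(C)\ne0$. Then $\mathrm{wt}(rC)=\mathrm{wt}(r(f_i(C)))$ or $\mathrm{wt}(rC)=s_i\,\mathrm{wt}(r(f_i(C)))$.
   Context: $[\pm n]=\{1,\dots,n,\overline n,\dots,\overline1\}$ ($\overline i=-i$), ordered $1<\dots<n<\overline n<\dots<\overline1$. A column is a strictly increasing sequence, read top to bottom as a word; it is admissible if whenever $i,\overline i$ both occur, with $i$ in row $a$ from the top and $\overline i$ in row $b$ from the bottom, $a+b\le i$. For admissible $C$ with $z_1>\dots>z_r$ the $z\in[n]$ with $z,\overline z\in C$, let $t_1$ be the greatest $t\in[n]$ with $t<z_1$, $t,\overline t\notin C$, and $t_k$ the greatest $t\in[n]$ with $t<\min(t_{k-1},z_k)$, $t,\overline t\notin C$; $rC$ is obtained by replacing each $\overline{z_k}$ by $\overline{t_k}$ and reordering. $\mathrm{wt}$ of a word: $i$-th entry is (number of $i$'s) minus (number of $\overline i$'s). $f_i$ (signature rule): replace letters in $\{i,\overline{i+1}\}$ by $+$, letters in $\{i+1,\overline i\}$ by $-$ (for $i=n$: $n\mapsto+$, $\overline n\mapsto-$), ignore others, cancel adjacent $+-$ pairs repeatedly; $f_i$ changes the letter of the leftmost uncancelled $+$ ($i\mapsto i+1$ if $i<n$, $\overline{i+1}\mapsto\overline i$, $n\mapsto\overline n$ if $i=n$), or is $0$ if none; applied to an admissible column it yields an admissible column. $s_i$ acts on $\mathbb Z^n$ by swapping entries $i,i+1$ if $i<n$ and negating entry $n$ if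 $i=n$. -}

module Defs where

open import Data.Nat using (ℕ; zero; suc; _+_; _∸_; _≤_; _<_; _≡ᵇ_; _<ᵇ_; _⊓_)
open import Data.Integer using (ℤ; +_; -_; _-_)
open import Data.Bool using (Bool; true; false; if_then_else_; _∧_; not; _∨_)
open import Data.List using (List; []; _∷_; length; lookup; filter; map; downFrom; foldr)
open import Data.List.Relation.Unary.All using (All)
open import Data.List.Relation.Unary.Linked using (Linked)
open import Data.Maybe using (Maybe; just; nothing)
open import Data.Product using (_×_; _,_)
open import Data.Fin using (Fin; toℕ)
open import Data.Vec using (Vec; tabulate)
import Data.Vec as V
open import Relation.Binary.PropositionalEquality using (_≡_)

-- Letters of [±n]:  pos k = k,  neg k = k̄ = -k   (k ∈ [n], 1-indexed)

data Letter : Set where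
  pos : ℕ → Letter
  neg : ℕ → Letter

InRange : ℕ → Letter → Set
InRange n (pos k) = 1 ≤ k × k ≤ n
InRange n (neg k) = 1 ≤ k × k ≤ n

-- position in the order 1 < … < n < n̄ < … < 1̄
key : ℕ → Letter → ℕ
key n (pos k) = k
key n (neg k) = (n + n + 1) ∸ k

_==L_ : Letter → Letter → Bool
pos a ==L pos b = a ≡ᵇ b
neg a ==L neg b = a ≡ᵇ b
_ ==L _ = false

-- A column: a strictly increasing word in [±n] (read top to bottom)
IsColumn : ℕ → List Letter → Set
IsColumn n C = All (InRange n) C × Linked (λ x y → key n x < key n y) C

-- Admissibility: if i occurs in row a from the top (1-indexed) and
-- ī in row b from the bottom (1-indexed), then a + b ≤ i.
Admissible : List Letter → Set
Admissible C = ∀ (i : ℕ) (p q : Fin (length C)) →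
  lookup C p ≡ pos i → lookup C q ≡ neg i →
  (toℕ p + 1) + (length C ∸ toℕ q) ≤ i

elem : Letter → List Letter → Bool
elem x [] = false
elem x (y ∷ ys) = (x ==L y) ∨ elem x ys

free : List Letter → ℕ → Bool
free C t = not (elem (pos t) C) ∧ not (elem (neg t) C)

greatestFreeBelow : List Letter → ℕ → Maybe ℕ
greatestFreeBelow C zero = nothing
greatestFreeBelow C (suc m) =
  if (0 <ᵇ m) ∧ free C m then just m else greatestFreeBelow C m

zs : ℕ → List Letter → List ℕ
zs n C = filter (λ z → Data.Bool._≟_ (elem (pos z) C ∧ elem (neg z) C) true)
                (map suc (downFrom n))

-- pairs (z_k , t_k); the first argument is the bound t_{k-1}
-- (initially n+1, so that min(n+1, z₁) = z₁)
tpairs : List Letter → ℕ → List ℕ → Maybe (List (ℕ × ℕ))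
tpairs C prev [] = just []
tpairs C prev (z ∷ rest) with greatestFreeBelow C (prev ⊓ z)
... | nothing = nothing
... | just t with tpairs C t rest
...   | nothing = nothing
...   | just ps = just ((z , t) ∷ ps)

replaceBar : List (ℕ × ℕ) → Letter → Letter
replaceBar [] x = x
replaceBar ((z , t) ∷ ps) (pos k) = pos k
replaceBar ((z , t) ∷ ps) (neg k) = if k ≡ᵇ z then neg t else replaceBar ps (neg k)

insertL : ℕ → Letter → List Letter → List Letter
insertL n x [] = x ∷ []
insertL n x (y ∷ ys) = if key n x <ᵇ key n y then x ∷ y ∷ ys else y ∷ insertL n x ys

sortL : ℕ → List Letter → List Letter
sortL n = foldr (insertL n) []

r : ℕ → List Letter → Maybe (List Letter)
r n C with tpairs C (suc n) (zs n C)
... | nothing = nothing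
... | just ps = just (sortL n (map (replaceBar ps) C))

count : Letter → List Letter → ℕ
count x [] = 0
count x (y ∷ ys) = if x ==L y then suc (count x ys) else count x ys

wt : (n : ℕ) → List Letter → Vec ℤ n
wt n w = tabulate (λ j → (+ count (pos (suc (toℕ j))) w) - (+ count (neg (suc (toℕ j))) w))

-- 1-indexed entry (0 outside range)
get : {n : ℕ} → Vec ℤ n → ℕ → ℤ
get V.[] k = + 0
get (x V.∷ v) zero = + 0
get (x V.∷ v) (suc zero) = x
get (x V.∷ v) (suc (suc k)) = get v (suc k)

s : (n : ℕ) → ℕ → Vec ℤ n → Vec ℤ n
s n i v = tabulate λ j → entry (suc (toℕ j))
  where
  entry : ℕ → ℤ
  entry k = if i <ᵇ n
            then (if k ≡ᵇ i then get v (suc i)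
                  else if k ≡ᵇ suc i then get v i else get v k)
            else (if k ≡ᵇ n then - get v k else get v k)

data Sign : Set where
  plus minus none : Sign

sign : ℕ → ℕ → Letter → Sign
sign n i x = if i <ᵇ n then lt x else eqn x
  where
  lt : Letter → Sign
  lt (pos k) = if k ≡ᵇ i then plus else if k ≡ᵇ suc i then minus else none
  lt (neg k) = if k ≡ᵇ suc i then plus else if k ≡ᵇ i then minus else none
  eqn : Letter → Sign
  eqn (pos k) = if k ≡ᵇ n then plus else none
  eqn (neg k) = if k ≡ᵇ n then minus else none

-- scan left to right; the stack holds positions of uncancelled +'s
-- (most recent first); a − cancels the most recent uncancelled +
-- (this is the repeated cancellation of adjacent +− pairs).
scan : ℕ → ℕ → ℕ → List Letter → List ℕ → List ℕ
scan n i pos₀ [] st = st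
scan n i pos₀ (x ∷ xs) st with sign n i x
... | plus = scan n i (suc pos₀) xs (pos₀ ∷ st)
... | none = scan n i (suc pos₀) xs st
... | minus with st
...   | [] = scan n i (suc pos₀) xs []
...   | _ ∷ st' = scan n i (suc pos₀) xs st'

lastM : List ℕ → Maybe ℕ
lastM [] = nothing
lastM (x ∷ []) = just x
lastM (x ∷ y ∷ ys) = lastM (y ∷ ys)

changeLetter : ℕ → ℕ → Letter → Letter
changeLetter n i (pos k) = if i <ᵇ n then pos (suc k) else neg k
changeLetter n i (neg k) = neg (k ∸ 1)

changeAt : ℕ → ℕ → ℕ → List Letter → List Letter
changeAt n i p [] = []
changeAt n i zero (x ∷ xs) = changeLetter n i x ∷ xs
changeAt n i (suc p) (x ∷ xs) = x ∷ changeAt n i p xs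

-- f_i w : nothing stands for 0
f : ℕ → ℕ → List Letter → Maybe (List Letter)
f n i w with lastM (scan n i 0 w [])
... | nothing = nothing
... | just p = just (changeAt n i p w)

-- The t_k of rC come from a bracket matching of levels: scanning the levels
-- n, n−1, …, 1, each doubled level z (z and z̄ in C) waits for a partner, and
-- each vacant level t (neither t nor t̄ in C) is the partner of a waiting one
-- if there is any.  Admissibility bounds, below each doubled z, the number of
-- doubled levels by the number of vacant ones, so every doubled level finds a
-- partner, and the entry of wt(rC) at a level only depends on its occupancy
-- and on whether it is a partner.  On a column, f_i turns i into i+1 or
-- (i+1)‾ into ī (and f_n turns n into n̄).  The scans of C and f_i(C) agree
-- above i+1; a case check of the levels i+1 and i shows that both leave the
-- same number of waiting levels, so the scans agree below i as well, and the
-- entries at i and i+1 are unchanged or swapped (for i = n, the entry at n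
-- changes sign).

module Submission where

open import Defs
open import Data.Nat
  using (ℕ; zero; suc; _+_; _∸_; _≤_; _<_; _>_; _≤′_; ≤′-refl; ≤′-step; _≡ᵇ_; _<ᵇ_; _⊓_; z≤n; s≤s; z<s)
open import Data.Nat.Properties
open import Data.Bool using (Bool; true; false; if_then_else_; _∧_; _∨_; not)
open import Data.Bool.Properties using (∧-zeroʳ; ∧-comm)
open import Data.Integer using (ℤ; -_; _⊖_)
open import Data.Integer.Properties using (+-cancelˡ-⊖; [+m]-[+n]≡m⊖n)
open import Data.Fin using (Fin; toℕ)
open import Data.Fin.Properties using (toℕ<n)
open import Data.List using (List; []; _∷_; [_]; map; length; _++_; filterᵇ)
open import Data.List.Properties using (map-id; map-cong; map-∘; ++-assoc; length-++)
open import Data.List.Membership.Propositional using (_∈_)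
open import Data.List.Relation.Unary.All as All using (All; []; _∷_)
import Data.List.Relation.Unary.All.Properties as All
open import Data.List.Relation.Unary.AllPairs using (AllPairs; []; _∷_)
import Data.List.Relation.Unary.AllPairs.Properties as AllPairs
open import Data.List.Relation.Unary.Any using (here; there; index)
open import Data.List.Relation.Unary.Any.Properties using (lookup-index)
open import Data.List.Relation.Unary.Linked using ([-]; _∷_)
open import Data.List.Relation.Unary.Linked.Properties using (Linked⇒AllPairs)
open import Data.Maybe using (Maybe; just; nothing)
import Data.Maybe as Maybe
open import Data.Product using (∃-syntax; _×_; _,_; proj₁; proj₂)
import Data.Product as Product
open import Data.Sum using (_⊎_; inj₁; inj₂)
import Data.Sum as Sum
open import Data.Unit using (⊤; tt)
open import Data.Empty using (⊥; ⊥-elim)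
open import Data.Vec using (Vec; tabulate)
open import Data.Vec.Properties using (tabulate-cong)
open import Function using (_∘_; case_of_)
open import Relation.Unary using (_⊆_)
open import Relation.Nullary using (yes; no; contradiction)
open import Relation.Nullary.Reflects using (Reflects; ofʸ; ofⁿ; fromEquivalence; det)
open import Relation.Binary.PropositionalEquality hiding ([_])
open import Algebra.Properties.CommutativeSemigroup +-commutativeSemigroup
  using (interchange; x∙yz≈y∙xz; x∙yz≈xz∙y; xy∙z≈xz∙y; xy∙z≈zy∙x)

⟦_⟧ : Bool → ℕ
⟦ true ⟧ = 1
⟦ false ⟧ = 0

≡ᵇ-reflects : ∀ m n → Reflects (m ≡ n) (m ≡ᵇ n)
≡ᵇ-reflects m n = fromEquivalence (≡ᵇ⇒≡ m n) (≡⇒≡ᵇ m n)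

≡ᵇ-refl : ∀ m → (m ≡ᵇ m) ≡ true
≡ᵇ-refl m = det (≡ᵇ-reflects m m) (ofʸ refl)

≢⇒≡ᵇ≡false : ∀ {m n} → m ≢ n → (m ≡ᵇ n) ≡ false
≢⇒≡ᵇ≡false {m} {n} m≢n = det (≡ᵇ-reflects m n) (ofⁿ m≢n)

==L-reflects : ∀ x y → Reflects (x ≡ y) (x ==L y)
==L-reflects (pos a) (pos b) with a ≡ᵇ b | ≡ᵇ-reflects a b
... | true  | ofʸ refl = ofʸ refl
... | false | ofⁿ a≢b = ofⁿ λ { refl → a≢b refl }
==L-reflects (neg a) (neg b) with a ≡ᵇ b | ≡ᵇ-reflects a b
... | true  | ofʸ refl = ofʸ refl
... | false | ofⁿ a≢b = ofⁿ λ { refl → a≢b refl }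
==L-reflects (pos a) (neg b) = ofⁿ λ ()
==L-reflects (neg a) (pos b) = ofⁿ λ ()

==L-refl : ∀ x → (x ==L x) ≡ true
==L-refl x = det (==L-reflects x x) (ofʸ refl)

≢⇒==L≡false : ∀ {x y} → x ≢ y → (x ==L y) ≡ false
≢⇒==L≡false {x} {y} x≢y = det (==L-reflects x y) (ofⁿ x≢y)

<ᵇ-true : ∀ {m n} → m < n → (m <ᵇ n) ≡ true
<ᵇ-true {m} {n} m<n = det (<ᵇ-reflects-< m n) (ofʸ m<n)

<ᵇ-irrefl : ∀ m → (m <ᵇ m) ≡ false
<ᵇ-irrefl m = det (<ᵇ-reflects-< m m) (ofⁿ (<-irrefl refl))

key-neg : ∀ n → key n (neg n) ≡ suc n
key-neg n = trans (cong (_∸ n) (+-assoc n n 1)) (trans (m+n∸m≡n n (n + 1)) (+-comm n 1))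

count-∷ : ∀ x y L → count x (y ∷ L) ≡ ⟦ x ==L y ⟧ + count x L
count-∷ x y L with x ==L y
... | true = refl
... | false = refl

count-insertL : ∀ n x y L → count x (insertL n y L) ≡ count x (y ∷ L)
count-insertL n x y [] = refl
count-insertL n x y (z ∷ L) with key n y <ᵇ key n z
... | true = refl
... | false = begin
  count x (z ∷ insertL n y L)          ≡⟨ count-∷ x z (insertL n y L) ⟩
  ⟦ x ==L z ⟧ + count x (insertL n y L) ≡⟨ cong (⟦ x ==L z ⟧ +_) (trans (count-insertL n x y L) (count-∷ x y L)) ⟩
  ⟦ x ==L z ⟧ + (⟦ x ==L y ⟧ + count x L) ≡⟨ x∙yz≈y∙xz ⟦ x ==L z ⟧ ⟦ x ==L y ⟧ (count x L) ⟩
  ⟦ x ==L y ⟧ + (⟦ x ==L z ⟧ + count x L) ≡⟨ cong (⟦ x ==L y ⟧ +_) (count-∷ x z L) ⟨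
  ⟦ x ==L y ⟧ + count x (z ∷ L)         ≡⟨ count-∷ x y (z ∷ L) ⟨
  count x (y ∷ z ∷ L)                   ∎
  where open ≡-Reasoning

count-sortL : ∀ n x L → count x (sortL n L) ≡ count x L
count-sortL n x [] = refl
count-sortL n x (y ∷ L) = begin
  count x (insertL n y (sortL n L)) ≡⟨ count-insertL n x y (sortL n L) ⟩
  count x (y ∷ sortL n L)           ≡⟨ count-∷ x y (sortL n L) ⟩
  ⟦ x ==L y ⟧ + count x (sortL n L) ≡⟨ cong (⟦ x ==L y ⟧ +_) (count-sortL n x L) ⟩
  ⟦ x ==L y ⟧ + count x L           ≡⟨ count-∷ x y L ⟨
  count x (y ∷ L)                   ∎
  where open ≡-Reasoning

neg-injective : ∀ {a b} → neg a ≡ neg b → a ≡ b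
neg-injective refl = refl

pos-injective : ∀ {a b} → pos a ≡ pos b → a ≡ b
pos-injective refl = refl

occurs≢absent : ∀ {x y} L → count x L ≡ 1 → count y L ≡ 0 → x ≢ y
occurs≢absent L cx cy refl = 1+n≢0 (trans (sym cx) cy)

renameBar : ℕ → ℕ → Letter → Letter
renameBar z t (pos k) = pos k
renameBar z t (neg k) = if k ≡ᵇ z then neg t else neg k

module _ (z t : ℕ) where

  count-renameBar-other : ∀ {j} → j ≢ z → j ≢ t → ∀ L → count (neg j) (map (renameBar z t) L) ≡ count (neg j) L
  count-renameBar-other j≢z j≢t [] = refl
  count-renameBar-other j≢z j≢t (pos k ∷ L) = count-renameBar-other j≢z j≢t L
  count-renameBar-other {j} j≢z j≢t (neg k ∷ L) with k ≡ᵇ z | ≡ᵇ-reflects k z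
  ... | true | ofʸ refl rewrite ≢⇒≡ᵇ≡false j≢z | ≢⇒≡ᵇ≡false j≢t = count-renameBar-other j≢z j≢t L
  ... | false | ofⁿ _ = cong (λ c → if j ≡ᵇ k then suc c else c) (count-renameBar-other j≢z j≢t L)

  count-renameBar-source : z ≢ t → ∀ L → count (neg z) (map (renameBar z t) L) ≡ 0
  count-renameBar-source z≢t [] = refl
  count-renameBar-source z≢t (pos k ∷ L) = count-renameBar-source z≢t L
  count-renameBar-source z≢t (neg k ∷ L) with k ≡ᵇ z | ≡ᵇ-reflects k z
  ... | true | ofʸ refl rewrite ≢⇒≡ᵇ≡false z≢t = count-renameBar-source z≢t L
  ... | false | ofⁿ k≢z rewrite ≢⇒≡ᵇ≡false (k≢z ∘ sym) = count-renameBar-source z≢t L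

  count-renameBar-target : z ≢ t → ∀ L →
    count (neg t) (map (renameBar z t) L) ≡ count (neg t) L + count (neg z) L
  count-renameBar-target z≢t [] = refl
  count-renameBar-target z≢t (pos k ∷ L) = count-renameBar-target z≢t L
  count-renameBar-target z≢t (neg k ∷ L) with k ≡ᵇ z | ≡ᵇ-reflects k z
  ... | true | ofʸ refl rewrite ≡ᵇ-refl t | ≡ᵇ-refl k | ≢⇒≡ᵇ≡false (z≢t ∘ sym) =
    trans (cong suc (count-renameBar-target z≢t L)) (sym (+-suc _ _))
  ... | false | ofⁿ k≢z rewrite ≢⇒≡ᵇ≡false (k≢z ∘ sym) with t ≡ᵇ k
  ...   | true = cong suc (count-renameBar-target z≢t L)
  ...   | false = count-renameBar-target z≢t L

  count-renameBar : ∀ L → count (neg z) L ≡ 1 → count (neg t) L ≡ 0 → ∀ j →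
    count (neg j) (map (renameBar z t) L) + ⟦ j ≡ᵇ z ⟧ ≡ count (neg j) L + ⟦ j ≡ᵇ t ⟧
  count-renameBar L cz ct j with j ≟ z | j ≟ t
  ... | yes refl | _
    rewrite ≡ᵇ-refl z | ≢⇒≡ᵇ≡false {z} {t} (occurs≢absent L cz ct ∘ cong neg)
          | count-renameBar-source (occurs≢absent L cz ct ∘ cong neg) L | cz = refl
  ... | no j≢z | yes refl
    rewrite ≢⇒≡ᵇ≡false j≢z | ≡ᵇ-refl t | count-renameBar-target (j≢z ∘ sym) L | ct | cz = refl
  ... | no j≢z | no j≢t rewrite ≢⇒≡ᵇ≡false j≢z | ≢⇒≡ᵇ≡false j≢t =
    cong (_+ 0) (count-renameBar-other j≢z j≢t L)

replaceBar-pos : ∀ ps k → replaceBar ps (pos k) ≡ pos k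
replaceBar-pos [] k = refl
replaceBar-pos (_ ∷ _) k = refl

pos==L-replaceBar : ∀ ps j x → (pos j ==L replaceBar ps x) ≡ (pos j ==L x)
pos==L-replaceBar ps j (pos k) = cong (pos j ==L_) (replaceBar-pos ps k)
pos==L-replaceBar [] j (neg k) = refl
pos==L-replaceBar ((z , t) ∷ ps) j (neg k) with k ≡ᵇ z
... | true = refl
... | false = pos==L-replaceBar ps j (neg k)

count-pos-replaceBar : ∀ ps j L → count (pos j) (map (replaceBar ps) L) ≡ count (pos j) L
count-pos-replaceBar ps j [] = refl
count-pos-replaceBar ps j (x ∷ L) = begin
  count (pos j) (replaceBar ps x ∷ map (replaceBar ps) L)         ≡⟨ count-∷ (pos j) (replaceBar ps x) (map (replaceBar ps) L) ⟩
  ⟦ pos j ==L replaceBar ps x ⟧ + count (pos j) (map (replaceBar ps) L)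
    ≡⟨ cong₂ (λ b c → ⟦ b ⟧ + c) (pos==L-replaceBar ps j x) (count-pos-replaceBar ps j L) ⟩
  ⟦ pos j ==L x ⟧ + count (pos j) L                               ≡⟨ count-∷ (pos j) x L ⟨
  count (pos j) (x ∷ L)                                           ∎
  where open ≡-Reasoning

replaceBar-fresh : ∀ ps t → All (λ p → proj₁ p ≢ t) ps → replaceBar ps (neg t) ≡ neg t
replaceBar-fresh [] t [] = refl
replaceBar-fresh ((z , _) ∷ ps) t (z≢t ∷ fresh)
  rewrite ≢⇒≡ᵇ≡false {t} {z} (z≢t ∘ sym) = replaceBar-fresh ps t fresh

replaceBar-∷ : ∀ z t ps → All (λ p → proj₁ p ≢ t) ps → ∀ x →
  replaceBar ((z , t) ∷ ps) x ≡ replaceBar ps (renameBar z t x)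
replaceBar-∷ z t ps fresh (pos k) = sym (replaceBar-pos ps k)
replaceBar-∷ z t ps fresh (neg k) with k ≡ᵇ z
... | true = sym (replaceBar-fresh ps t fresh)
... | false = refl

multiplicity : ℕ → List ℕ → ℕ
multiplicity j [] = 0
multiplicity j (x ∷ xs) = ⟦ j ≡ᵇ x ⟧ + multiplicity j xs

count-neg-replaceBar : ∀ ps L → AllPairs _>_ (map proj₁ ps) → AllPairs _>_ (map proj₂ ps) →
  All (λ p → count (neg (proj₁ p)) L ≡ 1 × count (neg (proj₂ p)) L ≡ 0) ps → ∀ j →
  count (neg j) (map (replaceBar ps) L) + multiplicity j (map proj₁ ps)
    ≡ count (neg j) L + multiplicity j (map proj₂ ps)
count-neg-replaceBar [] L _ _ _ j = cong (_+ 0) (cong (count (neg j)) (map-id L))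
count-neg-replaceBar ((z , t) ∷ ps) L (z>zs ∷ zs↓) (t>ts ∷ ts↓) ((cz , ct) ∷ counts) j = begin
  count (neg j) (map (replaceBar ((z , t) ∷ ps)) L) + (⟦ j ≡ᵇ z ⟧ + mz)
    ≡⟨ cong (λ M → count (neg j) M + (⟦ j ≡ᵇ z ⟧ + mz)) (trans (map-cong (replaceBar-∷ z t ps fresh) L) (map-∘ L)) ⟩
  X + (⟦ j ≡ᵇ z ⟧ + mz)      ≡⟨ x∙yz≈xz∙y X ⟦ j ≡ᵇ z ⟧ mz ⟩
  X + mz + ⟦ j ≡ᵇ z ⟧        ≡⟨ cong (_+ ⟦ j ≡ᵇ z ⟧) (count-neg-replaceBar ps L′ zs↓ ts↓ counts′ j) ⟩
  Y′ + mt + ⟦ j ≡ᵇ z ⟧       ≡⟨ xy∙z≈xz∙y Y′ mt ⟦ j ≡ᵇ z ⟧ ⟩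
  Y′ + ⟦ j ≡ᵇ z ⟧ + mt       ≡⟨ cong (_+ mt) (count-renameBar z t L cz ct j) ⟩
  Y + ⟦ j ≡ᵇ t ⟧ + mt        ≡⟨ +-assoc Y ⟦ j ≡ᵇ t ⟧ mt ⟩
  Y + (⟦ j ≡ᵇ t ⟧ + mt)      ∎
  where
  open ≡-Reasoning
  L′ = map (renameBar z t) L
  mz = multiplicity j (map proj₁ ps)
  mt = multiplicity j (map proj₂ ps)
  X = count (neg j) (map (replaceBar ps) L′)
  Y′ = count (neg j) L′
  Y = count (neg j) L
  fresh : All (λ p → proj₁ p ≢ t) ps
  fresh = All.map (λ (cz′ , _) → occurs≢absent L cz′ ct ∘ cong neg) counts
  counts′ : All (λ p → count (neg (proj₁ p)) L′ ≡ 1 × count (neg (proj₂ p)) L′ ≡ 0) ps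
  counts′ = preserve ps (All.map⁻ z>zs) (All.map⁻ t>ts) counts
    where
    preserve : ∀ qs → All (λ p → proj₁ p < z) qs → All (λ p → proj₂ p < t) qs →
      All (λ p → count (neg (proj₁ p)) L ≡ 1 × count (neg (proj₂ p)) L ≡ 0) qs →
      All (λ p → count (neg (proj₁ p)) L′ ≡ 1 × count (neg (proj₂ p)) L′ ≡ 0) qs
    preserve [] [] [] [] = []
    preserve ((z′ , t′) ∷ qs) (z′<z ∷ zs<z) (t′<t ∷ ts<t) ((cz′ , ct′) ∷ cs) =
      ( trans (count-renameBar-other z t (<⇒≢ z′<z) (occurs≢absent L cz′ ct ∘ cong neg) L) cz′
      , trans (count-renameBar-other z t (occurs≢absent L cz ct′ ∘ cong neg ∘ sym) (<⇒≢ t′<t) L) ct′)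
      ∷ preserve qs zs<z ts<t cs

Occupancy : Set
Occupancy = Bool × Bool

isDoubled isVacant : Occupancy → Bool
isDoubled (a , b) = a ∧ b
isVacant (a , b) = not a ∧ not b

occupancy : List Letter → ℕ → Occupancy
occupancy C k = elem (pos k) C , elem (neg k) C

doubled : List Letter → ℕ → Bool
doubled C k = isDoubled (occupancy C k)

-- The t_k are found by scanning the levels n, n−1, …, 1 while counting the
-- doubled levels q still waiting for a partner: a doubled level joins them,
-- a vacant level is the partner of one of them if q > 0.  The boolean says
-- whether the level is a partner.
matchStep : Occupancy → ℕ → Bool × ℕ
matchStep (true , true) q = false , suc q
matchStep (false , false) zero = false , zero
matchStep (false , false) (suc q) = true , q
matchStep (true , false) q = false , q
matchStep (false , true) q = false , q

emitIf : Bool → ℕ → Maybe (List ℕ) → Maybe (List ℕ)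
emitIf false p m = m
emitIf true p m = Maybe.map (p ∷_) m

match : (ℕ → Occupancy) → ℕ → ℕ → Maybe (List ℕ)
match O zero zero = just []
match O zero (suc q) = nothing
match O (suc j) q = emitIf (proj₁ (matchStep (O (suc j)) q)) (suc j) (match O j (proj₂ (matchStep (O (suc j)) q)))

map≡just⁻ : ∀ {A B : Set} (f : A → B) m {y} → Maybe.map f m ≡ just y → ∃[ x ] (m ≡ just x × f x ≡ y)
map≡just⁻ f (just x) refl = x , refl , refl

zs-suc : ∀ m C → zs (suc m) C ≡ (if doubled C (suc m) then suc m ∷ zs m C else zs m C)
zs-suc m C with doubled C (suc m)
... | true = refl
... | false = refl

greatestFreeBelow-≡just : ∀ C m p → free C p ≡ true → 0 < p → p < m →
  (∀ p′ → p < p′ → p′ < m → free C p′ ≡ false) → greatestFreeBelow C m ≡ just p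
greatestFreeBelow-≡just C (suc m) (suc p) fp _ p<1+m noFree with m ≟ suc p
... | yes refl rewrite fp = refl
... | no m≢1+p with ≤∧≢⇒< (≤-pred p<1+m) (m≢1+p ∘ sym)
...   | p<m rewrite noFree m p<m ≤-refl | ∧-zeroʳ (0 <ᵇ m) =
  greatestFreeBelow-≡just C m (suc p) fp z<s p<m (λ p′ p<p′ p′<m → noFree p′ p<p′ (m<n⇒m<1+n p′<m))

NoFreeAbove : List Letter → ℕ → ℕ → List ℕ → Set
NoFreeAbove C j prev [] = ⊤
NoFreeAbove C j prev (z ∷ _) = ∀ p → j < p → p < prev ⊓ z → free C p ≡ false

tpairs-∷ : ∀ C prev z rest {t ps} → greatestFreeBelow C (prev ⊓ z) ≡ just t → tpairs C t rest ≡ just ps →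
  tpairs C prev (z ∷ rest) ≡ just ((z , t) ∷ ps)
tpairs-∷ C prev z rest e1 e2 rewrite e1 | e2 = refl

tpairs-proj₁ : ∀ C prev L {ps} → tpairs C prev L ≡ just ps → map proj₁ ps ≡ L
tpairs-proj₁ C prev [] refl = refl
tpairs-proj₁ C prev (z ∷ L) e with greatestFreeBelow C (prev ⊓ z)
... | just t with tpairs C t L in e′
...   | just ps′ with e
...     | refl = cong (z ∷_) (tpairs-proj₁ C t L e′)

no-level-between : ∀ {j p} → j < p → p < suc j → ⊥
no-level-between j<p p<1+j = <-irrefl refl (<-≤-trans j<p (≤-pred p<1+j))

NoFreeAbove-step : ∀ C j prev pend → free C (suc j) ≡ false →
  NoFreeAbove C (suc j) prev pend → NoFreeAbove C j prev pend
NoFreeAbove-step C j prev [] _ _ = tt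
NoFreeAbove-step C j prev (z ∷ _) f≡false noFree p j<p p<prev⊓z with m≤n⇒m<n∨m≡n j<p
... | inj₁ 1+j<p = noFree p 1+j<p p<prev⊓z
... | inj₂ refl = f≡false

NoFreeAbove-waiting : ∀ C j prev pend → NoFreeAbove C j prev pend → NoFreeAbove C j prev (pend ++ [ suc j ])
NoFreeAbove-waiting C j prev [] _ p j<p p<prev⊓1+j = ⊥-elim (no-level-between j<p (<-≤-trans p<prev⊓1+j (m⊓n≤n prev (suc j))))
NoFreeAbove-waiting C j prev (_ ∷ _) noFree = noFree

NoFreeAbove-adjacent : ∀ C j pend → NoFreeAbove C j (suc j) pend
NoFreeAbove-adjacent C j [] = tt
NoFreeAbove-adjacent C j (_ ∷ _) p j<p p<1+j⊓z = ⊥-elim (no-level-between j<p (<-≤-trans p<1+j⊓z (m⊓n≤m (suc j) _)))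

zs-doubled : ∀ j C → doubled C (suc j) ≡ true → zs (suc j) C ≡ suc j ∷ zs j C
zs-doubled j C d = trans (zs-suc j C) (cong (λ b → if b then suc j ∷ zs j C else zs j C) d)

zs-undoubled : ∀ j C → doubled C (suc j) ≡ false → zs (suc j) C ≡ zs j C
zs-undoubled j C d = trans (zs-suc j C) (cong (λ b → if b then suc j ∷ zs j C else zs j C) d)

single-¬doubled : ∀ a → isDoubled (a , not a) ≡ false
single-¬doubled true = refl
single-¬doubled false = refl

single-¬vacant : ∀ a → isVacant (a , not a) ≡ false
single-¬vacant true = refl
single-¬vacant false = refl

-- tpairs, followed along the scan: pend holds the doubled levels above j
-- still waiting for a partner and prev the last partner found; no vacant level
-- between j and the bound of the next call to greatestFreeBelow was skipped.
tpairs-match : ∀ C j pend prev {ts} → j < prev → All (j <_) pend → NoFreeAbove C j prev pend →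
  match (occupancy C) j (length pend) ≡ just ts →
  ∃[ ps ] (tpairs C prev (pend ++ zs j C) ≡ just ps × map proj₂ ps ≡ ts)

tpairs-match-step : ∀ C j pend prev {ts} → suc j < prev → All (suc j <_) pend → NoFreeAbove C (suc j) prev pend →
  ∀ {o} → occupancy C (suc j) ≡ o →
  emitIf (proj₁ (matchStep o (length pend))) (suc j) (match (occupancy C) j (proj₂ (matchStep o (length pend)))) ≡ just ts →
  ∃[ ps ] (tpairs C prev (pend ++ zs (suc j) C) ≡ just ps × map proj₂ ps ≡ ts)

tpairs-match-single : ∀ C j pend prev {ts} → suc j < prev → All (suc j <_) pend → NoFreeAbove C (suc j) prev pend →
  ∀ {a} → occupancy C (suc j) ≡ (a , not a) → match (occupancy C) j (length pend) ≡ just ts →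
  ∃[ ps ] (tpairs C prev (pend ++ zs (suc j) C) ≡ just ps × map proj₂ ps ≡ ts)

tpairs-match C zero [] prev _ _ _ refl = [] , refl , refl
tpairs-match C (suc j) pend prev j<prev above noFree = tpairs-match-step C j pend prev j<prev above noFree refl

tpairs-match-step C j pend prev {ts} j<prev above noFree {true , true} o m
  with tpairs-match C j (pend ++ [ suc j ]) prev (<-trans (n<1+n j) j<prev)
         (All.++⁺ (All.map (<-trans (n<1+n j)) above) (n<1+n j ∷ []))
         (NoFreeAbove-waiting C j prev pend (NoFreeAbove-step C j prev pend (cong isVacant o) noFree))
         (subst (λ q → match (occupancy C) j q ≡ just ts) (sym (trans (length-++ pend) (+-comm (length pend) 1))) m)
... | ps , e , proj₂ps = ps , trans (cong (λ L → tpairs C prev (pend ++ L)) (zs-doubled j C (cong isDoubled o)))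
                                   (trans (cong (tpairs C prev) (sym (++-assoc pend [ suc j ] (zs j C)))) e) , proj₂ps
tpairs-match-step C j [] prev j<prev above noFree {false , false} o m
  with tpairs-match C j [] prev (<-trans (n<1+n j) j<prev) [] tt m
... | ps , e , proj₂ps = ps , trans (cong (tpairs C prev) (zs-undoubled j C (cong isDoubled o))) e , proj₂ps
tpairs-match-step C j (z ∷ pend) prev j<prev (1+j<z ∷ above) noFree {false , false} o m
  with map≡just⁻ (suc j ∷_) (match (occupancy C) j (length pend)) m
... | ts′ , m′ , refl
  with tpairs-match C j pend (suc j) (n<1+n j) (All.map (<-trans (n<1+n j)) above) (NoFreeAbove-adjacent C j pend) m′
...   | ps , e , proj₂ps = (z , suc j) ∷ ps
      , trans (cong (λ L → tpairs C prev (z ∷ pend ++ L)) (zs-undoubled j C (cong isDoubled o))) (tpairs-∷ C prev z _ greatest e)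
      , cong (suc j ∷_) proj₂ps
  where
  greatest : greatestFreeBelow C (prev ⊓ z) ≡ just (suc j)
  greatest = greatestFreeBelow-≡just C (prev ⊓ z) (suc j) (cong isVacant o) z<s (⊓-glb j<prev 1+j<z) noFree
tpairs-match-step C j pend prev j<prev above noFree {true , false} o m = tpairs-match-single C j pend prev j<prev above noFree o m
tpairs-match-step C j pend prev j<prev above noFree {false , true} o m = tpairs-match-single C j pend prev j<prev above noFree o m

tpairs-match-single C j pend prev j<prev above noFree {a} o m
  with tpairs-match C j pend prev (<-trans (n<1+n j) j<prev) (All.map (<-trans (n<1+n j)) above)
         (NoFreeAbove-step C j prev pend (trans (cong isVacant o) (single-¬vacant a)) noFree) m
... | ps , e , proj₂ps =
  ps , trans (cong (λ L → tpairs C prev (pend ++ L)) (zs-undoubled j C (trans (cong isDoubled o) (single-¬doubled a)))) e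
     , proj₂ps

tally : (ℕ → Bool) → ℕ → ℕ
tally g zero = 0
tally g (suc m) = tally g m + ⟦ g (suc m) ⟧

match-succeeds : ∀ O → (∀ m → tally (isDoubled ∘ O) m ≤ tally (isVacant ∘ O) m) →
  ∀ j q → q + tally (isDoubled ∘ O) j ≤ tally (isVacant ∘ O) j → ∃[ ts ] (match O j q ≡ just ts)
match-succeeds O hall zero zero _ = [] , refl
match-succeeds O hall (suc j) q bound with O (suc j)
... | true , true = match-succeeds O hall j (suc q)
  (subst₂ _≤_ (trans (cong (q +_) (+-comm Z 1)) (+-suc q Z)) (+-identityʳ F) bound)
  where Z = tally (isDoubled ∘ O) j
        F = tally (isVacant ∘ O) j
... | false , false with q
...   | zero = match-succeeds O hall j 0 (hall j)
...   | suc q with match-succeeds O hall j q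
                   (≤-pred (subst₂ _≤_ (cong (suc ∘ (q +_)) (+-identityʳ _)) (+-comm (tally (isVacant ∘ O) j) 1) bound))
...     | ts , m = suc j ∷ ts , cong (Maybe.map (suc j ∷_)) m
match-succeeds O hall (suc j) q bound | true , false =
  match-succeeds O hall j q (subst₂ _≤_ (cong (q +_) (+-identityʳ _)) (+-identityʳ _) bound)
match-succeeds O hall (suc j) q bound | false , true =
  match-succeeds O hall j q (subst₂ _≤_ (cong (q +_) (+-identityʳ _)) (+-identityʳ _) bound)

InLevels : ℕ → ℕ → Set
InLevels j t = 0 < t × t ≤ j

InLevels-suc : ∀ {j} → All (InLevels j) ⊆ All (InLevels (suc j))
InLevels-suc = All.map (λ (0<t , t≤j) → 0<t , m≤n⇒m≤1+n t≤j)

InLevels⇒< : ∀ {j} → All (InLevels j) ⊆ All (suc j >_)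
InLevels⇒< = All.map (λ (_ , t≤j) → s≤s t≤j)

match-props : ∀ O j q {ts} → match O j q ≡ just ts →
  All (λ t → isVacant (O t) ≡ true) ts × All (InLevels j) ts × AllPairs _>_ ts
match-props O zero zero refl = [] , [] , []
match-props O (suc j) q m with O (suc j) in o
... | true , true = Product.map₂ (Product.map₁ InLevels-suc) (match-props O j (suc q) m)
... | true , false = Product.map₂ (Product.map₁ InLevels-suc) (match-props O j q m)
... | false , true = Product.map₂ (Product.map₁ InLevels-suc) (match-props O j q m)
... | false , false with q
...   | zero = Product.map₂ (Product.map₁ InLevels-suc) (match-props O j 0 m)
...   | suc q with map≡just⁻ (suc j ∷_) (match O j q) m
...     | ts , m′ , refl with match-props O j q m′
...       | vacant , range , ts↓ = cong isVacant o ∷ vacant , (z<s , ≤-refl) ∷ InLevels-suc range , InLevels⇒< range ∷ ts↓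

zs-props : ∀ m C → All (λ z → doubled C z ≡ true) (zs m C) × All (InLevels m) (zs m C) × AllPairs _>_ (zs m C)
zs-props zero C = [] , [] , []
zs-props (suc m) C rewrite zs-suc m C with doubled C (suc m) in d
... | true = let dbl , range , zs↓ = zs-props m C in d ∷ dbl , (z<s , ≤-refl) ∷ InLevels-suc range , InLevels⇒< range ∷ zs↓
... | false = Product.map₂ (Product.map₁ InLevels-suc) (zs-props m C)

multiplicity-absent : ∀ j xs → All (j ≢_) xs → multiplicity j xs ≡ 0
multiplicity-absent j [] [] = refl
multiplicity-absent j (x ∷ xs) (j≢x ∷ rest) rewrite ≢⇒≡ᵇ≡false j≢x = multiplicity-absent j xs rest

multiplicity-above : ∀ {j k} ts → All (InLevels j) ts → j < k → multiplicity k ts ≡ 0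
multiplicity-above ts range j<k =
  multiplicity-absent _ ts (All.map (λ (_ , t≤j) k≡t → <⇒≢ (≤-<-trans t≤j j<k) (sym k≡t)) range)

multiplicity-zs : ∀ m C j → 0 < j → j ≤ m → multiplicity j (zs m C) ≡ ⟦ doubled C j ⟧
multiplicity-zs zero C (suc j) 0<j ()
multiplicity-zs (suc m) C j 0<j j≤1+m rewrite zs-suc m C with j ≟ suc m
... | yes refl with doubled C (suc m)
...   | true rewrite ≡ᵇ-refl m = cong suc (multiplicity-above (zs m C) (proj₁ (proj₂ (zs-props m C))) ≤-refl)
...   | false = multiplicity-above (zs m C) (proj₁ (proj₂ (zs-props m C))) ≤-refl
multiplicity-zs (suc m) C j 0<j j≤1+m | no j≢1+m with doubled C (suc m)
...   | true rewrite ≢⇒≡ᵇ≡false j≢1+m = multiplicity-zs m C j 0<j (≤-pred (≤∧≢⇒< j≤1+m j≢1+m))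
...   | false = multiplicity-zs m C j 0<j (≤-pred (≤∧≢⇒< j≤1+m j≢1+m))

NoRepeats : List Letter → Set
NoRepeats L = ∀ x → count x L ≡ ⟦ elem x L ⟧

weightAt : List Letter → ℕ → ℤ
weightAt R j = count (pos j) R ⊖ count (neg j) R

-- The weight of rC at a level of occupancy (a , b) that is c times a t_k:
-- a doubled level passes its bar on to its partner.
levelWeight : Occupancy → ℕ → ℤ
levelWeight (a , b) c = (⟦ a ⟧ + ⟦ a ∧ b ⟧) ⊖ (⟦ b ⟧ + c)

levelWeight-char : ∀ a b x c → x + ⟦ a ∧ b ⟧ ≡ ⟦ b ⟧ + c → ⟦ a ⟧ ⊖ x ≡ levelWeight (a , b) c
levelWeight-char a b x c e = begin
  ⟦ a ⟧ ⊖ x                             ≡⟨ +-cancelˡ-⊖ ⟦ a ∧ b ⟧ ⟦ a ⟧ x ⟨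
  (⟦ a ∧ b ⟧ + ⟦ a ⟧) ⊖ (⟦ a ∧ b ⟧ + x)
    ≡⟨ cong₂ _⊖_ (+-comm ⟦ a ∧ b ⟧ ⟦ a ⟧) (trans (+-comm ⟦ a ∧ b ⟧ x) e) ⟩
  levelWeight (a , b) c                 ∎
  where open ≡-Reasoning

doubled⇒bar : ∀ C z → doubled C z ≡ true → elem (neg z) C ≡ true
doubled⇒bar C z d with elem (pos z) C | elem (neg z) C
doubled⇒bar C z refl | true | true = refl

doubled⇒unbarred : ∀ C z → doubled C z ≡ true → elem (pos z) C ≡ true
doubled⇒unbarred C z d with elem (pos z) C | elem (neg z) C
doubled⇒unbarred C z refl | true | true = refl

free⇒no-bar : ∀ C t → free C t ≡ true → elem (neg t) C ≡ false
free⇒no-bar C t f with elem (pos t) C | elem (neg t) C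
free⇒no-bar C t refl | false | false = refl

r-weight : ∀ n C {ts} → NoRepeats C → match (occupancy C) n 0 ≡ just ts →
  ∃[ R ] (r n C ≡ just R ×
    (∀ j → 0 < j → j ≤ n → weightAt R j ≡ levelWeight (occupancy C j) (multiplicity j ts)))
r-weight n C {ts} noRep m with tpairs-match C n [] (suc n) ≤-refl [] tt m
... | ps , tp , proj₂ps≡ts = R , r≡ , weight
  where
  R = sortL n (map (replaceBar ps) C)
  r≡ : r n C ≡ just R
  r≡ rewrite tp = refl
  proj₁ps≡zs : map proj₁ ps ≡ zs n C
  proj₁ps≡zs = tpairs-proj₁ C (suc n) (zs n C) tp
  zsProps = zs-props n C
  tsProps = match-props (occupancy C) n 0 m
  counts : All (λ p → count (neg (proj₁ p)) C ≡ 1 × count (neg (proj₂ p)) C ≡ 0) ps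
  counts = All.zipWith
    (λ (d , f) → trans (noRep _) (cong ⟦_⟧ (doubled⇒bar C _ d)) , trans (noRep _) (cong ⟦_⟧ (free⇒no-bar C _ f)))
    ( All.map⁻ (subst (All _) (sym proj₁ps≡zs) (proj₁ zsProps))
    , All.map⁻ (subst (All _) (sym proj₂ps≡ts) (proj₁ tsProps)))
  bars : ∀ j → 0 < j → j ≤ n → count (neg j) R + ⟦ doubled C j ⟧ ≡ ⟦ elem (neg j) C ⟧ + multiplicity j ts
  bars j 0<j j≤n = begin
    count (neg j) R + ⟦ doubled C j ⟧
      ≡⟨ cong₂ _+_ (count-sortL n (neg j) (map (replaceBar ps) C))
                   (sym (trans (cong (multiplicity j) proj₁ps≡zs) (multiplicity-zs n C j 0<j j≤n))) ⟩
    count (neg j) (map (replaceBar ps) C) + multiplicity j (map proj₁ ps)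
      ≡⟨ count-neg-replaceBar ps C (subst (AllPairs _>_) (sym proj₁ps≡zs) (proj₂ (proj₂ zsProps)))
                                   (subst (AllPairs _>_) (sym proj₂ps≡ts) (proj₂ (proj₂ tsProps))) counts j ⟩
    count (neg j) C + multiplicity j (map proj₂ ps)
      ≡⟨ cong₂ _+_ (noRep (neg j)) (cong (multiplicity j) proj₂ps≡ts) ⟩
    ⟦ elem (neg j) C ⟧ + multiplicity j ts ∎
    where open ≡-Reasoning
  weight : ∀ j → 0 < j → j ≤ n → weightAt R j ≡ levelWeight (occupancy C j) (multiplicity j ts)
  weight j 0<j j≤n = trans
    (cong (_⊖ count (neg j) R)
          (trans (count-sortL n (pos j) (map (replaceBar ps) C)) (trans (count-pos-replaceBar ps j C) (noRep (pos j)))))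
    (levelWeight-char (elem (pos j) C) (elem (neg j) C) (count (neg j) R) (multiplicity j ts) (bars j 0<j j≤n))

Sorted : ℕ → List Letter → Set
Sorted n = AllPairs (λ x y → key n x < key n y)

column-sorted : ∀ {n C} → IsColumn n C → Sorted n C
column-sorted (_ , linked) = Linked⇒AllPairs <-trans linked

key-below⇒∉ : ∀ n y L {K} → key n y ≤ K → All (λ w → K < key n w) L → elem y L ≡ false
key-below⇒∉ n y [] y≤K [] = refl
key-below⇒∉ n y (w ∷ L) y≤K (K<w ∷ above) with y ==L w | ==L-reflects y w
... | true | ofʸ refl = contradiction (<-≤-trans K<w y≤K) (<-irrefl refl)
... | false | _ = key-below⇒∉ n y L y≤K above

∉⇒count≡0 : ∀ x L → elem x L ≡ false → count x L ≡ 0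
∉⇒count≡0 x [] _ = refl
∉⇒count≡0 x (y ∷ L) x∉ with x ==L y
... | false = ∉⇒count≡0 x L x∉

sorted⇒noRepeats : ∀ n L → Sorted n L → NoRepeats L
sorted⇒noRepeats n [] [] x = refl
sorted⇒noRepeats n (y ∷ L) (above ∷ sorted) x with x ==L y | ==L-reflects x y
... | true | ofʸ refl = cong suc (∉⇒count≡0 x L (key-below⇒∉ n x L ≤-refl above))
... | false | _ = sorted⇒noRepeats n L sorted x

elem⇒∈ : ∀ x L → elem x L ≡ true → x ∈ L
elem⇒∈ x (y ∷ L) x∈ with x ==L y | ==L-reflects x y
... | true | ofʸ x≡y = here x≡y
... | false | _ = there (elem⇒∈ x L x∈)

tally-none : ∀ g m → (∀ k → 0 < k → k ≤ m → g k ≡ false) → tally g m ≡ 0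
tally-none g zero _ = refl
tally-none g (suc m) allFalse rewrite allFalse (suc m) z<s ≤-refl =
  trans (+-identityʳ _) (tally-none g m (λ k 0<k k≤m → allFalse k 0<k (m≤n⇒m≤1+n k≤m)))

tally-∨ : ∀ g h m → tally (λ k → g k ∨ h k) m ≤ tally g m + tally h m
tally-∨ g h zero = z≤n
tally-∨ g h (suc m) = begin
  tally (λ k → g k ∨ h k) m + ⟦ g (suc m) ∨ h (suc m) ⟧ ≤⟨ +-mono-≤ (tally-∨ g h m) (bit-∨ (g (suc m)) (h (suc m))) ⟩
  (tally g m + tally h m) + (⟦ g (suc m) ⟧ + ⟦ h (suc m) ⟧) ≡⟨ interchange (tally g m) (tally h m) _ _ ⟩
  (tally g m + ⟦ g (suc m) ⟧) + (tally h m + ⟦ h (suc m) ⟧) ∎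
  where
  open ≤-Reasoning
  bit-∨ : ∀ a b → ⟦ a ∨ b ⟧ ≤ ⟦ a ⟧ + ⟦ b ⟧
  bit-∨ true b = s≤s z≤n
  bit-∨ false b = ≤-refl

tally-==L≤1 : ∀ (f : ℕ → Letter) → (∀ {a b} → f a ≡ f b → a ≡ b) → ∀ x m → tally (λ k → f k ==L x) m ≤ 1
tally-==L≤1 f f-inj x zero = z≤n
tally-==L≤1 f f-inj x (suc m) with f (suc m) ==L x | ==L-reflects (f (suc m)) x
... | true | ofʸ refl = ≤-reflexive (cong (_+ 1)
  (tally-none _ m (λ k _ k≤m → ≢⇒==L≡false (λ fk≡ → <-irrefl (f-inj fk≡) (s≤s k≤m)))))
... | false | _ = subst (_≤ 1) (sym (+-identityʳ _)) (tally-==L≤1 f f-inj x m)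

tally-bars≤length : ∀ L m → tally (λ k → elem (neg k) L) m ≤ length L
tally-bars≤length [] m = ≤-reflexive (tally-none _ m (λ _ _ _ → refl))
tally-bars≤length (x ∷ L) m = ≤-trans (tally-∨ (λ k → neg k ==L x) (λ k → elem (neg k) L) m)
  (+-mono-≤ (tally-==L≤1 neg neg-injective x m) (tally-bars≤length L m))

module _ (n : ℕ) where

  tally-unbarred≤row : ∀ {z} L → Sorted n L → (z∈L : pos z ∈ L) →
    tally (λ k → elem (pos k) L) z ≤ suc (toℕ (index z∈L))
  tally-unbarred≤row {z} (_ ∷ L) (above ∷ _) (here refl) = begin
    tally (λ k → (pos k ==L pos z) ∨ elem (pos k) L) z
      ≤⟨ tally-∨ (λ k → pos k ==L pos z) (λ k → elem (pos k) L) z ⟩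
    tally (λ k → pos k ==L pos z) z + tally (λ k → elem (pos k) L) z
      ≤⟨ +-mono-≤ (tally-==L≤1 pos pos-injective (pos z) z)
                  (≤-reflexive (tally-none _ z (λ k _ k≤z → key-below⇒∉ n (pos k) L k≤z above))) ⟩
    1 + 0                                                         ∎
    where open ≤-Reasoning
  tally-unbarred≤row {z} (x ∷ L) (_ ∷ sorted) (there z∈L) =
    ≤-trans (tally-∨ (λ k → pos k ==L x) (λ k → elem (pos k) L) z)
            (+-mono-≤ (tally-==L≤1 pos pos-injective x z) (tally-unbarred≤row L sorted z∈L))

  tally-barred≤row : ∀ {z} L → Sorted n L → (z̄∈L : neg z ∈ L) →
    tally (λ k → elem (neg k) L) z ≤ length L ∸ toℕ (index z̄∈L)
  tally-barred≤row {z} L _ (here refl) = tally-bars≤length L z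
  tally-barred≤row {z} (x ∷ L) (above ∷ sorted) (there z̄∈L) =
    ≤-trans (tally-∨ (λ k → neg k ==L x) (λ k → elem (neg k) L) z)
            (≤-trans (≤-reflexive (cong (_+ tally (λ k → elem (neg k) L) z) (tally-none _ z (λ k _ → x≢k̄ k))))
                     (tally-barred≤row L sorted z̄∈L))
    where
    x<z̄ : key n x < key n (neg z)
    x<z̄ = All.lookup above z̄∈L
    x≢k̄ : ∀ k → k ≤ z → (neg k ==L x) ≡ false
    x≢k̄ k k≤z = ≢⇒==L≡false {neg k} {x} λ { refl → <-irrefl refl (<-≤-trans x<z̄ (∸-monoʳ-≤ (n + n + 1) k≤z)) }

tally-partition : ∀ C m →
  tally (λ k → elem (pos k) C) m + tally (λ k → elem (neg k) C) m + tally (free C) m ≡ m + tally (doubled C) m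
tally-partition C zero = refl
tally-partition C (suc m) = begin
  (P + a) + (N + b) + (F + ⟦ free C (suc m) ⟧)   ≡⟨ regroup P N F a b ⟦ free C (suc m) ⟧ ⟩
  (P + N + F) + (a + b + ⟦ free C (suc m) ⟧)
    ≡⟨ cong₂ _+_ (tally-partition C m) (level (elem (pos (suc m)) C) (elem (neg (suc m)) C)) ⟩
  (m + tally (doubled C) m) + (1 + ⟦ doubled C (suc m) ⟧) ≡⟨ +-suc _ _ ⟩
  suc (m + tally (doubled C) m + ⟦ doubled C (suc m) ⟧) ≡⟨ cong suc (+-assoc m _ _) ⟩
  suc m + (tally (doubled C) m + ⟦ doubled C (suc m) ⟧) ∎
  where
  open ≡-Reasoning
  open import Data.Nat.Tactic.RingSolver using (solve-∀)
  P = tally (λ k → elem (pos k) C) m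
  N = tally (λ k → elem (neg k) C) m
  F = tally (free C) m
  a = ⟦ elem (pos (suc m)) C ⟧
  b = ⟦ elem (neg (suc m)) C ⟧
  regroup : ∀ P N F a b f → (P + a) + (N + b) + (F + f) ≡ (P + N + F) + (a + b + f)
  regroup = solve-∀
  level : ∀ x y → ⟦ x ⟧ + ⟦ y ⟧ + ⟦ not x ∧ not y ⟧ ≡ 1 + ⟦ x ∧ y ⟧
  level true true = refl
  level true false = refl
  level false true = refl
  level false false = refl

-- The k ≤ z with k ∈ C sit in the rows down to z, those with k̄ ∈ C in the
-- rows from z̄ on, so admissibility bounds the two counts together by z.
hall-at-doubled : ∀ {n C} → IsColumn n C → Admissible C → ∀ z → doubled C z ≡ true →
  tally (doubled C) z ≤ tally (free C) z
hall-at-doubled {n} {C} col adm z d = +-cancelˡ-≤ z _ _ (begin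
  z + tally (doubled C) z ≡⟨ tally-partition C z ⟨
  P + N + F               ≤⟨ +-monoˡ-≤ F rows ⟩
  z + F                   ∎)
  where
  open ≤-Reasoning
  P = tally (λ k → elem (pos k) C) z
  N = tally (λ k → elem (neg k) C) z
  F = tally (free C) z
  z∈C = elem⇒∈ (pos z) C (doubled⇒unbarred C z d)
  z̄∈C = elem⇒∈ (neg z) C (doubled⇒bar C z d)
  rows : P + N ≤ z
  rows = begin
    P + N ≤⟨ +-mono-≤ (tally-unbarred≤row n C (column-sorted col) z∈C) (tally-barred≤row n C (column-sorted col) z̄∈C) ⟩
    suc (toℕ (index z∈C)) + (length C ∸ toℕ (index z̄∈C))
      ≡⟨ cong (_+ (length C ∸ toℕ (index z̄∈C))) (+-comm 1 (toℕ (index z∈C))) ⟩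
    (toℕ (index z∈C) + 1) + (length C ∸ toℕ (index z̄∈C))
      ≤⟨ adm z (index z∈C) (index z̄∈C) (sym (lookup-index z∈C)) (sym (lookup-index z̄∈C)) ⟩
    z ∎

admissible⇒hall : ∀ {n C} → IsColumn n C → Admissible C → ∀ m → tally (doubled C) m ≤ tally (free C) m
admissible⇒hall col adm zero = z≤n
admissible⇒hall {C = C} col adm (suc m) with doubled C (suc m) in d
... | true = subst (λ b → tally (doubled C) m + ⟦ b ⟧ ≤ tally (free C) (suc m)) d (hall-at-doubled col adm (suc m) d)
... | false = ≤-trans (≤-reflexive (+-identityʳ _)) (≤-trans (admissible⇒hall col adm m) (m≤m+n _ _))

admissible⇒match : ∀ {n C} → IsColumn n C → Admissible C → ∃[ ts ] (match (occupancy C) n 0 ≡ just ts)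
admissible⇒match {n} {C} col adm = match-succeeds (occupancy C) (admissible⇒hall col adm) n 0 (admissible⇒hall col adm n)

elem-filterᵇ : ∀ g w L → elem w (filterᵇ g L) ≡ g w ∧ elem w L
elem-filterᵇ g w [] with g w
... | true = refl
... | false = refl
elem-filterᵇ g w (y ∷ L) with g y in gy
... | true with w ==L y | ==L-reflects w y
...   | true | ofʸ refl rewrite gy = refl
...   | false | _ = elem-filterᵇ g w L
elem-filterᵇ g w (y ∷ L) | false with w ==L y | ==L-reflects w y
...   | true | ofʸ refl rewrite gy = trans (elem-filterᵇ g w L) (cong (_∧ elem w L) gy)
...   | false | _ = elem-filterᵇ g w L

sorted-unique : ∀ n L₁ L₂ → Sorted n L₁ → Sorted n L₂ → (∀ x → elem x L₁ ≡ elem x L₂) → L₁ ≡ L₂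
sorted-unique n [] [] _ _ _ = refl
sorted-unique n [] (y ∷ L₂) _ _ same = contradiction (trans (same y) (cong (_∨ elem y L₂) (==L-refl y))) λ ()
sorted-unique n (x ∷ L₁) [] _ _ same = contradiction (trans (sym (same x)) (cong (_∨ elem x L₁) (==L-refl x))) λ ()
sorted-unique n (x ∷ L₁) (y ∷ L₂) (above₁ ∷ sorted₁) (above₂ ∷ sorted₂) same with x ==L y | ==L-reflects x y
... | true | ofʸ refl = cong (x ∷_) (sorted-unique n L₁ L₂ sorted₁ sorted₂ same-tails)
  where
  same-tails : ∀ w → elem w L₁ ≡ elem w L₂
  same-tails w with w ==L x | ==L-reflects w x | same w
  ... | true | ofʸ refl | _ = trans (key-below⇒∉ n w L₁ ≤-refl above₁) (sym (key-below⇒∉ n w L₂ ≤-refl above₂))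
  ... | false | _ | same-w = same-w
... | false | ofⁿ x≢y =
  contradiction (All.lookup above₁ (elem⇒∈ y L₁ y∈L₁)) (<-asym (All.lookup above₂ (elem⇒∈ x L₂ x∈L₂)))
  where
  x∈L₂ : elem x L₂ ≡ true
  x∈L₂ = trans (sym (cong (_∨ elem x L₂) (≢⇒==L≡false x≢y)))
               (trans (sym (same x)) (cong (_∨ elem x L₁) (==L-refl x)))
  y∈L₁ : elem y L₁ ≡ true
  y∈L₁ = trans (sym (cong (_∨ elem y L₁) (≢⇒==L≡false (x≢y ∘ sym))))
               (trans (same y) (cong (_∨ elem y L₂) (==L-refl y)))

lookupℕ : List Letter → ℕ → Maybe Letter
lookupℕ [] p = nothing
lookupℕ (x ∷ L) zero = just x
lookupℕ (x ∷ L) (suc p) = lookupℕ L p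

isSigned : Sign → Bool
isSigned none = false
isSigned _ = true

Positioned : Set
Positioned = Letter × Sign × ℕ

letterSign : Positioned → Letter × Sign
letterSign (y , s , _) = y , s

pushPop : Sign → ℕ → List ℕ → List ℕ
pushPop plus p st = p ∷ st
pushPop minus p [] = []
pushPop minus p (_ ∷ st) = st
pushPop none p st = st

scanSigned : List Positioned → List ℕ → List ℕ
scanSigned [] st = st
scanSigned ((_ , s , p) ∷ T) st = scanSigned T (pushPop s p st)

data Positions : List (Letter × Sign) → List Positioned → Set where
  [] : Positions [] []
  _∷_ : ∀ {y s ys T} p → Positions ys T → Positions ((y , s) ∷ ys) ((y , s , p) ∷ T)

positions : ∀ T → Positions (map letterSign T) T
positions [] = []
positions ((_ , _ , p) ∷ T) = p ∷ positions T

selected : {A : Set} → List (A × Bool) → List A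
selected [] = []
selected ((a , true) ∷ xs) = a ∷ selected xs
selected ((a , false) ∷ xs) = selected xs

map-filterᵇ : ∀ {A : Set} (f : Letter → A) g L → map f (filterᵇ g L) ≡ selected (map (λ y → f y , g y) L)
map-filterᵇ f g [] = refl
map-filterᵇ f g (y ∷ L) with g y
... | true = cong (f y ∷_) (map-filterᵇ f g L)
... | false = map-filterᵇ f g L

module Signature (n i : ℕ) where

  signed : ℕ → List Letter → List Positioned
  signed p₀ [] = []
  signed p₀ (x ∷ L) = if isSigned (sign n i x) then (x , sign n i x , p₀) ∷ signed (suc p₀) L else signed (suc p₀) L

  scan≡scanSigned : ∀ p₀ L st → scan n i p₀ L st ≡ scanSigned (signed p₀ L) st
  scan≡scanSigned p₀ [] st = refl
  scan≡scanSigned p₀ (x ∷ L) st with sign n i x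
  ... | plus = scan≡scanSigned (suc p₀) L (p₀ ∷ st)
  ... | none = scan≡scanSigned (suc p₀) L st
  ... | minus with st
  ...   | [] = scan≡scanSigned (suc p₀) L []
  ...   | _ ∷ st′ = scan≡scanSigned (suc p₀) L st′

  signed-letters : ∀ p₀ L → map letterSign (signed p₀ L) ≡ map (λ y → y , sign n i y) (filterᵇ (isSigned ∘ sign n i) L)
  signed-letters p₀ [] = refl
  signed-letters p₀ (x ∷ L) with isSigned (sign n i x)
  ... | true = cong ((x , sign n i x) ∷_) (signed-letters (suc p₀) L)
  ... | false = signed-letters (suc p₀) L

  Located : List Letter → ℕ → Positioned → Set
  Located L p₀ (y , _ , p) = ∃[ k ] (p ≡ p₀ + k × lookupℕ L k ≡ just y)

  Located-∷ : ∀ x {L p₀ t} → Located L (suc p₀) t → Located (x ∷ L) p₀ t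
  Located-∷ x {p₀ = p₀} (k , e , l) = suc k , trans e (sym (+-suc p₀ k)) , l

  signed-located : ∀ p₀ L → All (Located L p₀) (signed p₀ L)
  signed-located p₀ [] = []
  signed-located p₀ (x ∷ L) with isSigned (sign n i x)
  ... | true = (0 , sym (+-identityʳ p₀) , refl) ∷ All.map (λ {t} → Located-∷ x {t = t}) (signed-located (suc p₀) L)
  ... | false = All.map (λ {t} → Located-∷ x {t = t}) (signed-located (suc p₀) L)

  signed-lookup : ∀ {C y s p} → (y , s , p) ∈ signed 0 C → lookupℕ C p ≡ just y
  signed-lookup {C} y∈ with All.lookup (signed-located 0 C) y∈
  ... | k , refl , l = l

  signed-selected : ∀ C W → Sorted n C → Sorted n W → (∀ w → isSigned (sign n i w) ≡ elem w W) →
    Positions (selected (map (λ y → (y , sign n i y) , elem y C) W)) (signed 0 C)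
  signed-selected C W sortedC sortedW signs = subst (λ ys → Positions ys (signed 0 C)) letters (positions (signed 0 C))
    where
    same : filterᵇ (isSigned ∘ sign n i) C ≡ filterᵇ (λ y → elem y C) W
    same = sorted-unique n _ _ (AllPairs.filter⁺ _ sortedC) (AllPairs.filter⁺ _ sortedW) λ w → begin
      elem w (filterᵇ (isSigned ∘ sign n i) C) ≡⟨ elem-filterᵇ (isSigned ∘ sign n i) w C ⟩
      isSigned (sign n i w) ∧ elem w C          ≡⟨ cong (_∧ elem w C) (signs w) ⟩
      elem w W ∧ elem w C                       ≡⟨ ∧-comm (elem w W) (elem w C) ⟩
      elem w C ∧ elem w W                       ≡⟨ elem-filterᵇ (λ y → elem y C) w W ⟨
      elem w (filterᵇ (λ y → elem y C) W)       ∎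
      where open ≡-Reasoning
    letters : map letterSign (signed 0 C) ≡ selected (map (λ y → (y , sign n i y) , elem y C) W)
    letters = trans (signed-letters 0 C) (trans (cong (map (λ y → y , sign n i y)) same) (map-filterᵇ _ (λ y → elem y C) W))

module SignatureBelow (n i : ℕ) (i<n : i < n) where
  open Signature n i

  signable : List Letter
  signable = pos i ∷ pos (suc i) ∷ neg (suc i) ∷ neg i ∷ []

  signable-sorted : Sorted n signable
  signable-sorted = Linked⇒AllPairs <-trans (n<1+n i ∷ i+1<i+1̄ ∷ i+1̄<ī ∷ [-])
    where
    i+1<i+1̄ : suc i < key n (neg (suc i))
    i+1<i+1̄ = <-≤-trans (s≤s i<n) (≤-trans (≤-reflexive (sym (key-neg n))) (∸-monoʳ-≤ (n + n + 1) i<n))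
    i+1̄<ī : key n (neg (suc i)) < key n (neg i)
    i+1̄<ī = ∸-monoʳ-< (n<1+n i) (≤-trans i<n (≤-trans (m≤m+n n n) (m≤m+n (n + n) 1)))

  isSigned-signable : ∀ w → isSigned (sign n i w) ≡ elem w signable
  isSigned-signable (pos k) rewrite <ᵇ-true i<n with k ≡ᵇ i | k ≡ᵇ suc i
  ... | true | _ = refl
  ... | false | true = refl
  ... | false | false = refl
  isSigned-signable (neg k) rewrite <ᵇ-true i<n with k ≡ᵇ suc i | k ≡ᵇ i
  ... | true | _ = refl
  ... | false | true = refl
  ... | false | false = refl

  selectedSignable : Bool → Bool → Bool → Bool → List (Letter × Sign)
  selectedSignable a a′ b′ b = selected
    (((pos i , plus) , a) ∷ ((pos (suc i) , minus) , a′) ∷ ((neg (suc i) , plus) , b′) ∷ ((neg i , minus) , b) ∷ [])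

  signed-signable : ∀ C → Sorted n C →
    Positions (selectedSignable (elem (pos i) C) (elem (pos (suc i)) C) (elem (neg (suc i)) C) (elem (neg i) C)) (signed 0 C)
  signed-signable C sorted =
    subst (λ ys → Positions ys (signed 0 C)) table (signed-selected C signable sorted signable-sorted isSigned-signable)
    where
    i≢1+i = <⇒≢ (n<1+n i)
    table : selected (map (λ y → (y , sign n i y) , elem y C) signable)
          ≡ selectedSignable (elem (pos i) C) (elem (pos (suc i)) C) (elem (neg (suc i)) C) (elem (neg i) C)
    table rewrite <ᵇ-true i<n | ≡ᵇ-refl i | ≢⇒≡ᵇ≡false (i≢1+i ∘ sym) | ≢⇒≡ᵇ≡false i≢1+i = refl

  leftmost-plus : ∀ a a′ b′ b {T} → Positions (selectedSignable a a′ b′ b) T →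
    ∀ {p} → lastM (scanSigned T []) ≡ just p →
    (a′ ≡ false × (b′ ≡ true ⊎ b ≡ false) × (pos i , plus , p) ∈ T) ⊎
    (b ≡ false × (a ≡ false ⊎ a′ ≡ true) × (neg (suc i) , plus , p) ∈ T)
  leftmost-plus false false false false [] ()
  leftmost-plus false false false true (_ ∷ []) ()
  leftmost-plus false false true false (_ ∷ []) refl = inj₂ (refl , inj₁ refl , here refl)
  leftmost-plus false false true true (_ ∷ _ ∷ []) ()
  leftmost-plus false true false false (_ ∷ []) ()
  leftmost-plus false true false true (_ ∷ _ ∷ []) ()
  leftmost-plus false true true false (_ ∷ _ ∷ []) refl = inj₂ (refl , inj₂ refl , there (here refl))
  leftmost-plus false true true true (_ ∷ _ ∷ _ ∷ []) ()
  leftmost-plus true false false false (_ ∷ []) refl = inj₁ (refl , inj₂ refl , here refl)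
  leftmost-plus true false false true (_ ∷ _ ∷ []) ()
  leftmost-plus true false true false (_ ∷ _ ∷ []) refl = inj₁ (refl , inj₁ refl , here refl)
  leftmost-plus true false true true (_ ∷ _ ∷ _ ∷ []) refl = inj₁ (refl , inj₁ refl , here refl)
  leftmost-plus true true false false (_ ∷ _ ∷ []) ()
  leftmost-plus true true false true (_ ∷ _ ∷ _ ∷ []) ()
  leftmost-plus true true true false (_ ∷ _ ∷ _ ∷ []) refl = inj₂ (refl , inj₂ refl , there (there (here refl)))
  leftmost-plus true true true true (_ ∷ _ ∷ _ ∷ _ ∷ []) ()

  data Effect (C : List Letter) (p : ℕ) : Set where
    raises : lookupℕ C p ≡ just (pos i) → elem (pos (suc i)) C ≡ false →
      elem (neg (suc i)) C ≡ true ⊎ elem (neg i) C ≡ false → Effect C p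
    lowers : lookupℕ C p ≡ just (neg (suc i)) → elem (neg i) C ≡ false →
      elem (pos i) C ≡ false ⊎ elem (pos (suc i)) C ≡ true → Effect C p

  effect : ∀ C → Sorted n C → ∀ {p} → lastM (scan n i 0 C []) ≡ just p → Effect C p
  effect C sorted last with leftmost-plus _ _ _ _ (signed-signable C sorted)
                                          (trans (cong lastM (sym (scan≡scanSigned 0 C []))) last)
  ... | inj₁ (i+1∉C , cond , at-p) = raises (signed-lookup {C} at-p) i+1∉C cond
  ... | inj₂ (ī∉C , cond , at-p) = lowers (signed-lookup {C} at-p) ī∉C cond

module SignatureTop (n : ℕ) where
  open Signature n n

  signable : List Letter
  signable = pos n ∷ neg n ∷ []

  signable-sorted : Sorted n signable
  signable-sorted = Linked⇒AllPairs <-trans (subst (n <_) (sym (key-neg n)) ≤-refl ∷ [-])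

  isSigned-signable : ∀ w → isSigned (sign n n w) ≡ elem w signable
  isSigned-signable (pos k) rewrite <ᵇ-irrefl n with k ≡ᵇ n
  ... | true = refl
  ... | false = refl
  isSigned-signable (neg k) rewrite <ᵇ-irrefl n with k ≡ᵇ n
  ... | true = refl
  ... | false = refl

  selectedSignable : Bool → Bool → List (Letter × Sign)
  selectedSignable a b = selected (((pos n , plus) , a) ∷ ((neg n , minus) , b) ∷ [])

  signed-signable : ∀ C → Sorted n C → Positions (selectedSignable (elem (pos n) C) (elem (neg n) C)) (signed 0 C)
  signed-signable C sorted =
    subst (λ ys → Positions ys (signed 0 C)) table (signed-selected C signable sorted signable-sorted isSigned-signable)
    where
    table : selected (map (λ y → (y , sign n n y) , elem y C) signable) ≡ selectedSignable (elem (pos n) C) (elem (neg n) C)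
    table rewrite <ᵇ-irrefl n | ≡ᵇ-refl n = refl

  leftmost-plus : ∀ a b {T} → Positions (selectedSignable a b) T → ∀ {p} → lastM (scanSigned T []) ≡ just p →
    b ≡ false × (pos n , plus , p) ∈ T
  leftmost-plus false false [] ()
  leftmost-plus false true (_ ∷ []) ()
  leftmost-plus true false (_ ∷ []) refl = refl , here refl
  leftmost-plus true true (_ ∷ _ ∷ []) ()

  effect : ∀ C → Sorted n C → ∀ {p} → lastM (scan n n 0 C []) ≡ just p →
    lookupℕ C p ≡ just (pos n) × elem (neg n) C ≡ false
  effect C sorted last with leftmost-plus (elem (pos n) C) (elem (neg n) C) (signed-signable C sorted)
                                          (trans (cong lastM (sym (scan≡scanSigned 0 C []))) last)
  ... | n̄∉C , at-p = signed-lookup {C} at-p , n̄∉C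

count-changeAt : ∀ n i L p {y} x → lookupℕ L p ≡ just y →
  count x (changeAt n i p L) + ⟦ x ==L y ⟧ ≡ count x L + ⟦ x ==L changeLetter n i y ⟧
count-changeAt n i (z ∷ L) zero {y} x refl = begin
  count x (changeLetter n i z ∷ L) + ⟦ x ==L z ⟧          ≡⟨ cong (_+ ⟦ x ==L z ⟧) (count-∷ x (changeLetter n i z) L) ⟩
  ⟦ x ==L changeLetter n i z ⟧ + count x L + ⟦ x ==L z ⟧
    ≡⟨ xy∙z≈zy∙x ⟦ x ==L changeLetter n i z ⟧ (count x L) ⟦ x ==L z ⟧ ⟩
  ⟦ x ==L z ⟧ + count x L + ⟦ x ==L changeLetter n i z ⟧  ≡⟨ cong (_+ ⟦ x ==L changeLetter n i z ⟧) (count-∷ x z L) ⟨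
  count x (z ∷ L) + ⟦ x ==L changeLetter n i z ⟧          ∎
  where open ≡-Reasoning
count-changeAt n i (z ∷ L) (suc p) {y} x at-p = begin
  count x (z ∷ changeAt n i p L) + ⟦ x ==L y ⟧              ≡⟨ cong (_+ ⟦ x ==L y ⟧) (count-∷ x z (changeAt n i p L)) ⟩
  ⟦ x ==L z ⟧ + count x (changeAt n i p L) + ⟦ x ==L y ⟧    ≡⟨ +-assoc ⟦ x ==L z ⟧ _ _ ⟩
  ⟦ x ==L z ⟧ + (count x (changeAt n i p L) + ⟦ x ==L y ⟧)  ≡⟨ cong (⟦ x ==L z ⟧ +_) (count-changeAt n i L p x at-p) ⟩
  ⟦ x ==L z ⟧ + (count x L + ⟦ x ==L changeLetter n i y ⟧)  ≡⟨ +-assoc ⟦ x ==L z ⟧ _ _ ⟨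
  ⟦ x ==L z ⟧ + count x L + ⟦ x ==L changeLetter n i y ⟧    ≡⟨ cong (_+ ⟦ x ==L changeLetter n i y ⟧) (count-∷ x z L) ⟨
  count x (z ∷ L) + ⟦ x ==L changeLetter n i y ⟧            ∎
  where open ≡-Reasoning

elem≡0<count : ∀ x L → elem x L ≡ (0 <ᵇ count x L)
elem≡0<count x [] = refl
elem≡0<count x (z ∷ L) with x ==L z
... | true = refl
... | false = elem≡0<count x L

lookupℕ⇒elem : ∀ L p {y} → lookupℕ L p ≡ just y → elem y L ≡ true
lookupℕ⇒elem (z ∷ L) zero refl = cong (_∨ elem z L) (==L-refl z)
lookupℕ⇒elem (z ∷ L) (suc p) {y} at-p with y ==L z
... | true = refl
... | false = lookupℕ⇒elem L p at-p

record Replaced (C D : List Letter) (y y′ : Letter) : Set where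
  field
    noRepeats : NoRepeats D
    old∉ : elem y D ≡ false
    new∈ : elem y′ D ≡ true
    others : ∀ x → x ≢ y → x ≢ y′ → elem x D ≡ elem x C

changeAt-replaces : ∀ n i C p {y} → NoRepeats C → lookupℕ C p ≡ just y → y ≢ changeLetter n i y →
  elem (changeLetter n i y) C ≡ false → Replaced C (changeAt n i p C) y (changeLetter n i y)
changeAt-replaces n i C p {y} noRep at-p y≢y′ y′∉C = record
  { noRepeats = noRepeats
  ; old∉ = count⇒elem y false count-y
  ; new∈ = count⇒elem y′ true count-y′
  ; others = λ x x≢y x≢y′ → count⇒elem x (elem x C) (count-other x x≢y x≢y′) }
  where
  D = changeAt n i p C
  y′ = changeLetter n i y
  counts : ∀ x → count x D + ⟦ x ==L y ⟧ ≡ ⟦ elem x C ⟧ + ⟦ x ==L y′ ⟧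
  counts x = trans (count-changeAt n i C p x at-p) (cong (_+ ⟦ x ==L y′ ⟧) (noRep x))
  count-y : count y D ≡ 0
  count-y = +-cancelʳ-≡ 1 (count y D) 0 (trans (cong (λ b → count y D + ⟦ b ⟧) (sym (==L-refl y)))
    (trans (counts y) (cong₂ (λ a b → ⟦ a ⟧ + ⟦ b ⟧) (lookupℕ⇒elem C p at-p) (≢⇒==L≡false y≢y′))))
  count-y′ : count y′ D ≡ 1
  count-y′ = trans (sym (+-identityʳ _)) (trans (cong (λ b → count y′ D + ⟦ b ⟧) (sym (≢⇒==L≡false (y≢y′ ∘ sym))))
    (trans (counts y′) (cong₂ (λ a b → ⟦ a ⟧ + ⟦ b ⟧) y′∉C (==L-refl y′))))
  count-other : ∀ x → x ≢ y → x ≢ y′ → count x D ≡ ⟦ elem x C ⟧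
  count-other x x≢y x≢y′ = trans (sym (+-identityʳ _)) (trans (cong (λ b → count x D + ⟦ b ⟧) (sym (≢⇒==L≡false x≢y)))
    (trans (counts x) (trans (cong (λ b → ⟦ elem x C ⟧ + ⟦ b ⟧) (≢⇒==L≡false x≢y′)) (+-identityʳ _))))
  count⇒elem : ∀ x b → count x D ≡ ⟦ b ⟧ → elem x D ≡ b
  count⇒elem x true c = trans (elem≡0<count x D) (cong (0 <ᵇ_) c)
  count⇒elem x false c = trans (elem≡0<count x D) (cong (0 <ᵇ_) c)
  noRepeats : NoRepeats D
  noRepeats x with x ==L y | ==L-reflects x y
  ... | true | ofʸ refl = trans count-y (cong ⟦_⟧ (sym (count⇒elem y false count-y)))
  ... | false | ofⁿ x≢y with x ==L y′ | ==L-reflects x y′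
  ...   | true | ofʸ refl = trans count-y′ (cong ⟦_⟧ (sym (count⇒elem y′ true count-y′)))
  ...   | false | ofⁿ x≢y′ =
    trans (count-other x x≢y x≢y′) (cong ⟦_⟧ (sym (count⇒elem x (elem x C) (count-other x x≢y x≢y′))))

-- f_i (i < n) turns i into i+1 or (i+1)‾ into ī; the arguments are the
-- occupancies of the levels i+1 and i before, then after.
data Move : Occupancy → Occupancy → Occupancy → Occupancy → Set where
  raise : ∀ {b′ b} → b′ ≡ true ⊎ b ≡ false → Move (false , b′) (true , b) (true , b′) (false , b)
  lower : ∀ {a′ a} → a ≡ false ⊎ a′ ≡ true → Move (a′ , true) (a , false) (a′ , false) (a , true)

record TwoLevels : Set where
  constructor ⟨_,_,_⟩
  field
    upperEmits lowerEmits : Bool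
    pendingBelow : ℕ
open TwoLevels

twoLevels : Occupancy → Occupancy → ℕ → TwoLevels
twoLevels u l q =
  ⟨ proj₁ (matchStep u q) , proj₁ (matchStep l (proj₂ (matchStep u q))) , proj₂ (matchStep l (proj₂ (matchStep u q))) ⟩

Swapped Unchanged : Occupancy → Occupancy → Occupancy → Occupancy → ℕ → Set
Swapped u l u′ l′ q =
  levelWeight l ⟦ lowerEmits (twoLevels u l q) ⟧ ≡ levelWeight u′ ⟦ upperEmits (twoLevels u′ l′ q) ⟧ ×
  levelWeight u ⟦ upperEmits (twoLevels u l q) ⟧ ≡ levelWeight l′ ⟦ lowerEmits (twoLevels u′ l′ q) ⟧
Unchanged u l u′ l′ q =
  levelWeight l ⟦ lowerEmits (twoLevels u l q) ⟧ ≡ levelWeight l′ ⟦ lowerEmits (twoLevels u′ l′ q) ⟧ ×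
  levelWeight u ⟦ upperEmits (twoLevels u l q) ⟧ ≡ levelWeight u′ ⟦ upperEmits (twoLevels u′ l′ q) ⟧

move-twoLevels : ∀ {u l u′ l′} → Move u l u′ l′ → ∀ q →
  pendingBelow (twoLevels u l q) ≡ pendingBelow (twoLevels u′ l′ q) × (Swapped u l u′ l′ q ⊎ Unchanged u l u′ l′ q)
move-twoLevels (raise {true} {true} _) zero = refl , inj₁ (refl , refl)
move-twoLevels (raise {true} {true} _) (suc q) = refl , inj₁ (refl , refl)
move-twoLevels (raise {true} {false} _) zero = refl , inj₁ (refl , refl)
move-twoLevels (raise {true} {false} _) (suc q) = refl , inj₁ (refl , refl)
move-twoLevels (raise {false} {false} _) zero = refl , inj₁ (refl , refl)
move-twoLevels (raise {false} {false} _) (suc q) = refl , inj₁ (refl , refl)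
move-twoLevels (raise {false} {true} (inj₁ ()))
move-twoLevels (raise {false} {true} (inj₂ ()))
move-twoLevels (lower {false} {false} _) zero = refl , inj₁ (refl , refl)
move-twoLevels (lower {false} {false} _) (suc q) = refl , inj₁ (refl , refl)
move-twoLevels (lower {true} {false} _) zero = refl , inj₂ (refl , refl)
move-twoLevels (lower {true} {false} _) (suc q) = refl , inj₂ (refl , refl)
move-twoLevels (lower {true} {true} _) zero = refl , inj₂ (refl , refl)
move-twoLevels (lower {true} {true} _) (suc q) = refl , inj₂ (refl , refl)
move-twoLevels (lower {false} {true} (inj₁ ()))
move-twoLevels (lower {false} {true} (inj₂ ()))

emitted : Bool → ℕ → List ℕ
emitted false p = []
emitted true p = [ p ]

emitIf-just⁻ : ∀ e p m {ts} → emitIf e p m ≡ just ts → ∃[ ts₀ ] (m ≡ just ts₀ × ts ≡ emitted e p ++ ts₀)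
emitIf-just⁻ false p (just ts₀) refl = ts₀ , refl , refl
emitIf-just⁻ true p (just ts₀) refl = ts₀ , refl , refl

emitIf-just : ∀ e p {m ts₀} → m ≡ just ts₀ → emitIf e p m ≡ just (emitted e p ++ ts₀)
emitIf-just false p refl = refl
emitIf-just true p refl = refl

multiplicity-++ : ∀ k xs ys → multiplicity k (xs ++ ys) ≡ multiplicity k xs + multiplicity k ys
multiplicity-++ k [] ys = refl
multiplicity-++ k (x ∷ xs) ys = trans (cong (⟦ k ≡ᵇ x ⟧ +_) (multiplicity-++ k xs ys)) (sym (+-assoc ⟦ k ≡ᵇ x ⟧ _ _))

multiplicity-emitted-≢ : ∀ e {k p} → k ≢ p → multiplicity k (emitted e p) ≡ 0
multiplicity-emitted-≢ false k≢p = refl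
multiplicity-emitted-≢ true k≢p rewrite ≢⇒≡ᵇ≡false k≢p = refl

multiplicity-emitted-≡ : ∀ e p → multiplicity p (emitted e p) ≡ ⟦ e ⟧
multiplicity-emitted-≡ false p = refl
multiplicity-emitted-≡ true p rewrite ≡ᵇ-refl p = refl

match-cong : ∀ O O′ j q → (∀ k → 0 < k → k ≤ j → O k ≡ O′ k) → match O j q ≡ match O′ j q
match-cong O O′ zero zero _ = refl
match-cong O O′ zero (suc q) _ = refl
match-cong O O′ (suc j) q same rewrite same (suc j) z<s ≤-refl =
  cong (emitIf (proj₁ (matchStep (O′ (suc j)) q)) (suc j))
       (match-cong O O′ j (proj₂ (matchStep (O′ (suc j)) q)) (λ k 0<k k≤j → same k 0<k (m≤n⇒m≤1+n k≤j)))

weightOf : (ℕ → Occupancy) → List ℕ → ℕ → ℤ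
weightOf O ts k = levelWeight (O k) (multiplicity k ts)

module MoveAt (i₀ : ℕ) (O O′ : ℕ → Occupancy)
  (agree : ∀ k → k ≢ suc i₀ → k ≢ suc (suc i₀) → O′ k ≡ O k)
  (move : Move (O (suc (suc i₀))) (O (suc i₀)) (O′ (suc (suc i₀))) (O′ (suc i₀))) where

  private
    i = suc i₀

  Local : List ℕ → List ℕ → Set
  Local ts ts′ = (weightOf O ts i ≡ weightOf O′ ts′ (suc i) × weightOf O ts (suc i) ≡ weightOf O′ ts′ i)
               ⊎ (weightOf O ts i ≡ weightOf O′ ts′ i × weightOf O ts (suc i) ≡ weightOf O′ ts′ (suc i))

  Related : List ℕ → List ℕ → Set
  Related ts ts′ = (∀ k → k ≢ i → k ≢ suc i → multiplicity k ts ≡ multiplicity k ts′) × Local ts ts′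

  Related-emitted : ∀ e p → suc i < p → ∀ {ts ts′} → Related ts ts′ → Related (emitted e p ++ ts) (emitted e p ++ ts′)
  Related-emitted e p i+1<p {ts} {ts′} (others , local) =
    others′ , Sum.map (Product.map (lift i<p i+1<p) (lift i+1<p i<p)) (Product.map (lift i<p i<p) (lift i+1<p i+1<p)) local
    where
    mult : ∀ k xs → k < p → multiplicity k (emitted e p ++ xs) ≡ multiplicity k xs
    mult k xs k<p = trans (multiplicity-++ k (emitted e p) xs) (cong (_+ multiplicity k xs) (multiplicity-emitted-≢ e (<⇒≢ k<p)))
    i<p = <-trans (n<1+n i) i+1<p
    lift : ∀ {k k′} → k < p → k′ < p → weightOf O ts k ≡ weightOf O′ ts′ k′ →
      weightOf O (emitted e p ++ ts) k ≡ weightOf O′ (emitted e p ++ ts′) k′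
    lift {k} {k′} k<p k′<p w =
      trans (cong (levelWeight (O k)) (mult k ts k<p)) (trans w (sym (cong (levelWeight (O′ k′)) (mult k′ ts′ k′<p))))
    others′ : ∀ k → k ≢ i → k ≢ suc i → multiplicity k (emitted e p ++ ts) ≡ multiplicity k (emitted e p ++ ts′)
    others′ k k≢i k≢i+1 = trans (multiplicity-++ k (emitted e p) ts)
      (trans (cong (multiplicity k (emitted e p) +_) (others k k≢i k≢i+1)) (sym (multiplicity-++ k (emitted e p) ts′)))

  private
    layers : ∀ e₁ e₂ rest → All (InLevels i₀) rest → let ts = emitted e₁ (suc i) ++ emitted e₂ i ++ rest in
      multiplicity (suc i) ts ≡ ⟦ e₁ ⟧ × multiplicity i ts ≡ ⟦ e₂ ⟧ ×
      (∀ k → k ≢ i → k ≢ suc i → multiplicity k ts ≡ multiplicity k rest)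
    layers e₁ e₂ rest below =
        trans (split (suc i))
              (trans (cong₂ _+_ (multiplicity-emitted-≡ e₁ (suc i))
                                (cong₂ _+_ (multiplicity-emitted-≢ e₂ 1+n≢n)
                                           (multiplicity-above rest below (m<n⇒m<1+n (n<1+n i₀)))))
                     (+-identityʳ ⟦ e₁ ⟧))
      , trans (split i) (trans (cong₂ _+_ (multiplicity-emitted-≢ e₁ (<⇒≢ (n<1+n i)))
                                          (cong₂ _+_ (multiplicity-emitted-≡ e₂ i) (multiplicity-above rest below (n<1+n i₀))))
                               (+-identityʳ ⟦ e₂ ⟧))
      , λ k k≢i k≢i+1 → trans (split k) (cong₂ _+_ (multiplicity-emitted-≢ e₁ k≢i+1)
                                               (cong (_+ multiplicity k rest) (multiplicity-emitted-≢ e₂ k≢i)))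
      where
      split : ∀ k → multiplicity k (emitted e₁ (suc i) ++ emitted e₂ i ++ rest)
                    ≡ multiplicity k (emitted e₁ (suc i)) + (multiplicity k (emitted e₂ i) + multiplicity k rest)
      split k = trans (multiplicity-++ k (emitted e₁ (suc i)) _)
                      (cong (multiplicity k (emitted e₁ (suc i)) +_) (multiplicity-++ k (emitted e₂ i) rest))

  match-move-base : ∀ q {ts} → match O (suc i) q ≡ just ts → ∃[ ts′ ] (match O′ (suc i) q ≡ just ts′ × Related ts ts′)
  match-move-base q m with emitIf-just⁻ (proj₁ (matchStep (O (suc i)) q)) (suc i) (match O i (proj₂ (matchStep (O (suc i)) q))) m
  ... | ts₁ , m₁ , refl with emitIf-just⁻ (lowerEmits (twoLevels (O (suc i)) (O i) q)) i
                               (match O i₀ (pendingBelow (twoLevels (O (suc i)) (O i) q))) m₁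
  ... | rest , m₂ , refl =
    emitted e₁′ (suc i) ++ emitted e₂′ i ++ rest , emitIf-just e₁′ (suc i) (emitIf-just e₂′ i m₂′) , related
    where
    T = twoLevels (O (suc i)) (O i) q
    T′ = twoLevels (O′ (suc i)) (O′ i) q
    e₁′ = upperEmits T′
    e₂′ = lowerEmits T′
    ts = emitted (upperEmits T) (suc i) ++ emitted (lowerEmits T) i ++ rest
    ts′ = emitted e₁′ (suc i) ++ emitted e₂′ i ++ rest
    restBelow = proj₁ (proj₂ (match-props O i₀ _ m₂))
    mult = layers (upperEmits T) (lowerEmits T) rest restBelow
    mult′ = layers e₁′ e₂′ rest restBelow
    via : ∀ {k k′ c c′} → multiplicity k ts ≡ c → multiplicity k′ ts′ ≡ c′ →
      levelWeight (O k) c ≡ levelWeight (O′ k′) c′ → weightOf O ts k ≡ weightOf O′ ts′ k′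
    via {k} {k′} e e′ w = trans (cong (levelWeight (O k)) e) (trans w (sym (cong (levelWeight (O′ k′)) e′)))
    related : Related ts ts′
    related = (λ k k≢i k≢i+1 → trans (proj₂ (proj₂ mult) k k≢i k≢i+1) (sym (proj₂ (proj₂ mult′) k k≢i k≢i+1)))
            , Sum.map (Product.map (via (proj₁ (proj₂ mult)) (proj₁ mult′)) (via (proj₁ mult) (proj₁ (proj₂ mult′))))
                      (Product.map (via (proj₁ (proj₂ mult)) (proj₁ (proj₂ mult′))) (via (proj₁ mult) (proj₁ mult′)))
                      (proj₂ (move-twoLevels move q))
    m₂′ : match O′ i₀ (pendingBelow T′) ≡ just rest
    m₂′ = trans (sym (match-cong O O′ i₀ (pendingBelow T′) below))
                (subst (λ q → match O i₀ q ≡ just rest) (proj₁ (move-twoLevels move q)) m₂)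
      where
      below : ∀ k → 0 < k → k ≤ i₀ → O k ≡ O′ k
      below k _ k≤i₀ = sym (agree k (<⇒≢ (s≤s k≤i₀)) (<⇒≢ (m<n⇒m<1+n (s≤s k≤i₀))))

  match-move : ∀ {j} → suc i ≤′ j → ∀ q {ts} → match O j q ≡ just ts →
    ∃[ ts′ ] (match O′ j q ≡ just ts′ × Related ts ts′)
  match-move ≤′-refl = match-move-base
  match-move (≤′-step {j} i+1≤′j) q m
    rewrite agree (suc j) (λ e → <-irrefl (sym e) (<-trans (n<1+n i) (s≤s (≤′⇒≤ i+1≤′j))))
                          (λ e → <-irrefl (sym e) (s≤s (≤′⇒≤ i+1≤′j)))
    with emitIf-just⁻ (proj₁ (matchStep (O (suc j)) q)) (suc j) (match O j (proj₂ (matchStep (O (suc j)) q))) m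
  ... | ts₀ , m₀ , refl with match-move i+1≤′j (proj₂ (matchStep (O (suc j)) q)) m₀
  ...   | ts₀′ , m₀′ , related =
    emitted e (suc j) ++ ts₀′ , emitIf-just e (suc j) m₀′ , Related-emitted e (suc j) (s≤s (≤′⇒≤ i+1≤′j)) related
    where e = proj₁ (matchStep (O (suc j)) q)

negate-top : ∀ n₀ (O O′ : ℕ → Occupancy) → (∀ k → k ≢ suc n₀ → O′ k ≡ O k) →
  O (suc n₀) ≡ (true , false) → O′ (suc n₀) ≡ (false , true) → ∀ {ts} → match O (suc n₀) 0 ≡ just ts →
  match O′ (suc n₀) 0 ≡ just ts × weightOf O ts (suc n₀) ≡ - weightOf O′ ts (suc n₀)
negate-top n₀ O O′ agree top top′ {ts} m rewrite top | top′ =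
  trans (sym (match-cong O O′ n₀ 0 (λ k _ k≤n₀ → sym (agree k (<⇒≢ (s≤s k≤n₀)))))) m ,
  subst (λ c → levelWeight (true , false) c ≡ - levelWeight (false , true) c)
        (sym (multiplicity-above ts (proj₁ (proj₂ (match-props O n₀ 0 m))) ≤-refl)) refl

levels : ∀ n → (ℕ → ℤ) → Vec ℤ n
levels n h = tabulate (λ j → h (suc (toℕ j)))

wt≡levels : ∀ n R → wt n R ≡ levels n (weightAt R)
wt≡levels n R = tabulate-cong (λ j → [+m]-[+n]≡m⊖n (count (pos (suc (toℕ j))) R) (count (neg (suc (toℕ j))) R))

levels-cong : ∀ n {h h′} → (∀ k → 0 < k → k ≤ n → h k ≡ h′ k) → levels n h ≡ levels n h′
levels-cong n same = tabulate-cong (λ j → same (suc (toℕ j)) z<s (toℕ<n j))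

get-levels : ∀ n h k → k < n → get (levels n h) (suc k) ≡ h (suc k)
get-levels (suc n) h zero _ = refl
get-levels (suc n) h (suc k) (s≤s k<n) = get-levels n (h ∘ suc) k k<n

levels-swap : ∀ n i {h h′} → 0 < i → i < n → h i ≡ h′ (suc i) → h (suc i) ≡ h′ i →
  (∀ k → 0 < k → k ≤ n → k ≢ i → k ≢ suc i → h k ≡ h′ k) → levels n h ≡ s n i (levels n h′)
levels-swap n (suc i₀) {h} {h′} _ i<n at-i at-i+1 others = tabulate-cong entry
  where
  i = suc i₀
  v = levels n h′
  entry : ∀ (j : Fin n) → h (suc (toℕ j)) ≡
    (if i <ᵇ n
     then (if suc (toℕ j) ≡ᵇ i then get v (suc i) else if suc (toℕ j) ≡ᵇ suc i then get v i else get v (suc (toℕ j)))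
     else (if suc (toℕ j) ≡ᵇ n then - get v (suc (toℕ j)) else get v (suc (toℕ j))))
  entry j rewrite <ᵇ-true i<n with suc (toℕ j) ≡ᵇ i | ≡ᵇ-reflects (suc (toℕ j)) i
  ... | true | ofʸ e = trans (cong h e) (trans at-i (sym (get-levels n h′ i i<n)))
  ... | false | ofⁿ j≢i with suc (toℕ j) ≡ᵇ suc i | ≡ᵇ-reflects (suc (toℕ j)) (suc i)
  ...   | true | ofʸ e = trans (cong h e) (trans at-i+1 (sym (get-levels n h′ i₀ (<-trans (n<1+n i₀) i<n))))
  ...   | false | ofⁿ j≢i+1 =
    trans (others (suc (toℕ j)) z<s (toℕ<n j) j≢i j≢i+1) (sym (get-levels n h′ (toℕ j) (toℕ<n j)))

levels-negate : ∀ n₀ {h h′} → h (suc n₀) ≡ - h′ (suc n₀) → (∀ k → 0 < k → k ≤ n₀ → h k ≡ h′ k) →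
  levels (suc n₀) h ≡ s (suc n₀) (suc n₀) (levels (suc n₀) h′)
levels-negate n₀ {h} {h′} at-n others = tabulate-cong entry
  where
  n = suc n₀
  v = levels n h′
  entry : ∀ (j : Fin n) → h (suc (toℕ j)) ≡
    (if n <ᵇ n
     then (if suc (toℕ j) ≡ᵇ n then get v (suc n) else if suc (toℕ j) ≡ᵇ suc n then get v n else get v (suc (toℕ j)))
     else (if suc (toℕ j) ≡ᵇ n then - get v (suc (toℕ j)) else get v (suc (toℕ j))))
  entry j rewrite <ᵇ-irrefl n with suc (toℕ j) ≡ᵇ n | ≡ᵇ-reflects (suc (toℕ j)) n
  ... | true | ofʸ e = trans (cong h e) (trans at-n (cong -_ (trans (sym (get-levels n h′ n₀ ≤-refl)) (cong (get v) (sym e)))))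
  ... | false | ofⁿ j≢n =
    trans (others (suc (toℕ j)) z<s (≤-pred (≤∧≢⇒< (toℕ<n j) j≢n))) (sym (get-levels n h′ (toℕ j) (toℕ<n j)))

WeightsRelated : ℕ → ℕ → List Letter → List Letter → Set
WeightsRelated n i C D =
  ∃[ R ] ∃[ R′ ] (r n C ≡ just R × r n D ≡ just R′ × (wt n R ≡ wt n R′ ⊎ wt n R ≡ s n i (wt n R′)))

wt≡levels-weightOf : ∀ n C R ts →
  (∀ j → 0 < j → j ≤ n → weightAt R j ≡ levelWeight (occupancy C j) (multiplicity j ts)) →
  wt n R ≡ levels n (weightOf (occupancy C) ts)
wt≡levels-weightOf n C R ts w = trans (wt≡levels n R) (levels-cong n w)

agree-except : ∀ {h h′ : ℕ → ℤ} i i′ → h i ≡ h′ i → h i′ ≡ h′ i′ →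
  (∀ k → k ≢ i → k ≢ i′ → h k ≡ h′ k) → ∀ k → h k ≡ h′ k
agree-except {h} i i′ at-i at-i′ others k with k ≟ i | k ≟ i′
... | yes refl | _ = at-i
... | no _ | yes refl = at-i′
... | no k≢i | no k≢i′ = others k k≢i k≢i′

r-weight-move : ∀ n i₀ C D → suc (suc i₀) ≤ n → NoRepeats C → NoRepeats D →
  (agree : ∀ k → k ≢ suc i₀ → k ≢ suc (suc i₀) → occupancy D k ≡ occupancy C k) →
  Move (occupancy C (suc (suc i₀))) (occupancy C (suc i₀)) (occupancy D (suc (suc i₀))) (occupancy D (suc i₀)) →
  ∀ {ts} → match (occupancy C) n 0 ≡ just ts → WeightsRelated n (suc i₀) C D
r-weight-move n i₀ C D i+1≤n noRepC noRepD agree move {ts} m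
  with MoveAt.match-move i₀ (occupancy C) (occupancy D) agree move (≤⇒≤′ i+1≤n) 0 m
... | ts′ , m′ , sameMult , local with r-weight n C noRepC m | r-weight n D noRepD m′
... | R , rC , wR | R′ , rD , wR′ = R , R′ , rC , rD , weights local
  where
  i = suc i₀
  O = occupancy C
  O′ = occupancy D
  others : ∀ k → k ≢ i → k ≢ suc i → weightOf O ts k ≡ weightOf O′ ts′ k
  others k k≢i k≢i+1 = cong₂ levelWeight (sym (agree k k≢i k≢i+1)) (sameMult k k≢i k≢i+1)
  weights : MoveAt.Local i₀ (occupancy C) (occupancy D) agree move ts ts′ → wt n R ≡ wt n R′ ⊎ wt n R ≡ s n i (wt n R′)
  weights (inj₁ (at-i , at-i+1)) = inj₂ (trans (wt≡levels-weightOf n C R ts wR)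
    (trans (levels-swap n i z<s (<-≤-trans (n<1+n i) i+1≤n) at-i at-i+1 (λ k _ _ → others k))
           (cong (s n i) (sym (wt≡levels-weightOf n D R′ ts′ wR′)))))
  weights (inj₂ (at-i , at-i+1)) = inj₁ (trans (wt≡levels-weightOf n C R ts wR)
    (trans (levels-cong n (λ k _ _ → agree-except {weightOf O ts} {weightOf O′ ts′} i (suc i) at-i at-i+1 others k))
           (sym (wt≡levels-weightOf n D R′ ts′ wR′))))

r-weight-negate : ∀ n₀ C D → NoRepeats C → NoRepeats D → (∀ k → k ≢ suc n₀ → occupancy D k ≡ occupancy C k) →
  occupancy C (suc n₀) ≡ (true , false) → occupancy D (suc n₀) ≡ (false , true) →
  ∀ {ts} → match (occupancy C) (suc n₀) 0 ≡ just ts → WeightsRelated (suc n₀) (suc n₀) C D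
r-weight-negate n₀ C D noRepC noRepD agree top top′ {ts} m with negate-top n₀ (occupancy C) (occupancy D) agree top top′ m
... | m′ , at-n with r-weight (suc n₀) C noRepC m | r-weight (suc n₀) D noRepD m′
... | R , rC , wR | R′ , rD , wR′ = R , R′ , rC , rD , inj₂ (trans (wt≡levels-weightOf (suc n₀) C R ts wR)
  (trans (levels-negate n₀ at-n
           (λ k _ k≤n₀ → cong (λ o → levelWeight o (multiplicity k ts)) (sym (agree k (<⇒≢ (s≤s k≤n₀))))))
         (cong (s (suc n₀) (suc n₀)) (sym (wt≡levels-weightOf (suc n₀) D R′ ts wR′)))))

f≡just⁻ : ∀ n i C {D} → f n i C ≡ just D → ∃[ p ] (lastM (scan n i 0 C []) ≡ just p × D ≡ changeAt n i p C)
f≡just⁻ n i C fC with lastM (scan n i 0 C []) | fC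
... | just p | refl = p , refl , refl

Move-resp : ∀ {u l u′ l′ u₀ l₀ u₀′ l₀′} → u ≡ u₀ → l ≡ l₀ → u′ ≡ u₀′ → l′ ≡ l₀′ →
  Move u₀ l₀ u₀′ l₀′ → Move u l u′ l′
Move-resp refl refl refl refl move = move

f-move : ∀ n i C {D} → i < n → IsColumn n C → f n i C ≡ just D →
  NoRepeats D × (∀ k → k ≢ i → k ≢ suc i → occupancy D k ≡ occupancy C k) ×
  Move (occupancy C (suc i)) (occupancy C i) (occupancy D (suc i)) (occupancy D i)
f-move n i C i<n col fC with f≡just⁻ n i C fC
... | p , last , refl with SignatureBelow.effect n i i<n C (column-sorted col) last
...   | SignatureBelow.raises at-p i+1∉C cond = noRepeats rep , agree , move
  where
  open Replaced
  raised : changeLetter n i (pos i) ≡ pos (suc i)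
  raised rewrite <ᵇ-true i<n = refl
  rep : Replaced C (changeAt n i p C) (pos i) (pos (suc i))
  rep = subst (Replaced C _ (pos i)) raised (changeAt-replaces n i C p (sorted⇒noRepeats n C (column-sorted col)) at-p
          (λ e → <-irrefl (pos-injective (trans e raised)) (n<1+n i)) (trans (cong (λ y → elem y C) raised) i+1∉C))
  agree : ∀ k → k ≢ i → k ≢ suc i → occupancy (changeAt n i p C) k ≡ occupancy C k
  agree k k≢i k≢i+1 =
    cong₂ _,_ (others rep (pos k) (k≢i ∘ pos-injective) (k≢i+1 ∘ pos-injective)) (others rep (neg k) (λ ()) (λ ()))
  move : Move (occupancy C (suc i)) (occupancy C i) (occupancy (changeAt n i p C) (suc i)) (occupancy (changeAt n i p C) i)
  move = Move-resp (cong (_, elem (neg (suc i)) C) i+1∉C) (cong (_, elem (neg i) C) (lookupℕ⇒elem C p at-p))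
                   (cong₂ _,_ (new∈ rep) (others rep (neg (suc i)) (λ ()) (λ ())))
                   (cong₂ _,_ (old∉ rep) (others rep (neg i) (λ ()) (λ ())))
                   (raise cond)
...   | SignatureBelow.lowers at-p ī∉C cond = noRepeats rep , agree , move
  where
  open Replaced
  rep : Replaced C (changeAt n i p C) (neg (suc i)) (neg i)
  rep = changeAt-replaces n i C p (sorted⇒noRepeats n C (column-sorted col)) at-p (1+n≢n ∘ neg-injective) ī∉C
  agree : ∀ k → k ≢ i → k ≢ suc i → occupancy (changeAt n i p C) k ≡ occupancy C k
  agree k k≢i k≢i+1 =
    cong₂ _,_ (others rep (pos k) (λ ()) (λ ())) (others rep (neg k) (k≢i+1 ∘ neg-injective) (k≢i ∘ neg-injective))
  move : Move (occupancy C (suc i)) (occupancy C i) (occupancy (changeAt n i p C) (suc i)) (occupancy (changeAt n i p C) i)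
  move = Move-resp (cong (elem (pos (suc i)) C ,_) (lookupℕ⇒elem C p at-p)) (cong (elem (pos i) C ,_) ī∉C)
                   (cong₂ _,_ (others rep (pos (suc i)) (λ ()) (λ ())) (old∉ rep))
                   (cong₂ _,_ (others rep (pos i) (λ ()) (λ ())) (new∈ rep))
                   (lower cond)

f-negate : ∀ n C {D} → IsColumn n C → f n n C ≡ just D →
  NoRepeats D × (∀ k → k ≢ n → occupancy D k ≡ occupancy C k) ×
  occupancy C n ≡ (true , false) × occupancy D n ≡ (false , true)
f-negate n C col fC with f≡just⁻ n n C fC
... | p , last , refl with SignatureTop.effect n C (column-sorted col) last
...   | at-p , n̄∉C = noRepeats rep , agree , cong₂ _,_ (lookupℕ⇒elem C p at-p) n̄∉C , cong₂ _,_ (old∉ rep) (new∈ rep)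
  where
  open Replaced
  negated : changeLetter n n (pos n) ≡ neg n
  negated rewrite <ᵇ-irrefl n = refl
  rep : Replaced C (changeAt n n p C) (pos n) (neg n)
  rep = subst (Replaced C _ (pos n)) negated (changeAt-replaces n n C p (sorted⇒noRepeats n C (column-sorted col)) at-p
          (λ e → case trans e negated of λ ()) (trans (cong (λ y → elem y C) negated) n̄∉C))
  agree : ∀ k → k ≢ n → occupancy (changeAt n n p C) k ≡ occupancy C k
  agree k k≢n = cong₂ _,_ (others rep (pos k) (k≢n ∘ pos-injective) (λ ())) (others rep (neg k) (λ ()) (k≢n ∘ neg-injective))

lemma4p11 : (n i : ℕ) → 1 ≤ i → i ≤ n →
    (C : List Letter) → IsColumn n C → Admissible C →
    (D : List Letter) → f n i C ≡ just D →
    ∃[ R ] ∃[ R' ] (r n C ≡ just R × r n D ≡ just R' ×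
      (wt n R ≡ wt n R' ⊎ wt n R ≡ s n i (wt n R')))
lemma4p11 n (suc i₀) _ i≤n C col adm D fC with admissible⇒match col adm | m≤n⇒m<n∨m≡n i≤n
... | ts , m | inj₁ i<n =
  let noRepD , agree , move = f-move n (suc i₀) C i<n col fC
  in r-weight-move n i₀ C D i<n (sorted⇒noRepeats n C (column-sorted col)) noRepD agree move m
... | ts , m | inj₂ refl =
  let noRepD , agree , top , top′ = f-negate n C col fC
  in r-weight-negate i₀ C D (sorted⇒noRepeats n C (column-sorted col)) noRepD agree top top′ m
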